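{- For every integer $q>2$ there exists an orientable sequence of order $3$ over $\mathbb{Z}_q$ with period at least \[ \begin{cases} q\bigl(\tfrac{q(q-1)}{2}-1\bigr) & \text{if $q$ is odd},\\ q\bigl(\tfrac{q(q-1)}{2}-2\bigr) & \text{if $q$ is even and } q\neq 6,\\ q\bigl(\tfrac{q(q-1)}{2}-3\bigr) & \text{if } q=6. \end{cases} \]
   Context: Sequences are periodic with entries in $\mathbb{Z}_q$. For a sequence $S=(s_i)$ write $\mathbf{s}_n(i)=(s_i,\ldots,s_{i+n-1})$, and for an $n$-tuple $\mathbf{u}=(u_0,\ldots,u_{n-1})$ let $\mathbf{u}^R=(u_{n-1},\ldots,u_0)$. A periodic sequence $S$ of period $m$ is an $n$-window sequence if $\mathbf{s}_n(i)=\mathbf{s}_n(j)$ implies $i\equiv j\pmod m$. An $n$-window sequence is an orientable sequence of order $n$ if $\mathbf{s}_n(i)\neq \mathbf{s}_n(j)^R$ for all $i,j$. (The paper obtains such a sequence by a specific construction: a maximal-period negative orientable sequence of order 2, possibly shortened to have unit weight, lifted by the inverse Lempel homomorphism.) -}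

module Defs where

open import Data.Nat using (ℕ; zero; suc; _+_; _*_; _∸_; _/_; _%_; _≡ᵇ_; NonZero)
open import Data.Nat.DivMod using (_mod_)
open import Data.Fin using (Fin; toℕ)
open import Data.Vec using (Vec; tabulate; reverse)
open import Data.Bool using (if_then_else_)
open import Relation.Binary.PropositionalEquality using (_≡_; _≢_)

IsPeriodic : {q : ℕ} → (ℕ → Fin q) → ℕ → Set
IsPeriodic s m = ∀ i → s (i + m) ≡ s i

window : {q : ℕ} → (ℕ → Fin q) → (n : ℕ) → ℕ → Vec (Fin q) n
window s n i = tabulate (λ k → s (i + toℕ k))

IsWindowSeq : {q : ℕ} → (ℕ → Fin q) → (n m : ℕ) → .{{NonZero m}} → Set
IsWindowSeq s n m = ∀ i j → window s n i ≡ window s n j → i % m ≡ j % m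

IsOrientable : {q : ℕ} → (ℕ → Fin q) → (n m : ℕ) → .{{NonZero m}} → Set
IsOrientable s n m =
  IsPeriodic s m × IsWindowSeq s n m × (∀ i j → window s n i ≢ reverse (window s n j))
  where open import Data.Product using (_×_)

bound : ℕ → ℕ
bound q = q * ((q * (q ∸ 1)) / 2 ∸ c)
  where
  c : ℕ
  c = if q % 2 ≡ᵇ 1 then 1 else (if q ≡ᵇ 6 then 3 else 2)

-- Partial sums (the inverse Lempel homomorphism) lift a closed walk t on ℤ_q of unit weight Σ t to a sequence of
-- period q · (length of t).  Two equal 3-windows of the lift come from two equal arcs (t i, t (i + 1)) of the walk, and a
-- 3-window equal to a reversed one from an arc (a, b) whose negated reverse (−b, −a) is also an arc.  So it suffices to
-- find a closed walk with pairwise distinct arcs, none the negated reverse of another, of unit weight and length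
-- q (q − 1)/2 − c.  The arcs with a + b ≢ 0 fall into the pairs {(a, b), (−b, −a)}, and we choose between the two by
-- the sum a + b: N "blocks" v, σ − v, v + 1, σ − v − 1, … take all arcs with sums 1, …, 2N, while the sums near q/2
-- are covered by a zigzag 0, α, 1, α − 1, … and by 2-cycles inserted into the first block.  Splicing these walks and,
-- where the weight is not yet a unit, deleting one loop gives the walk, separately for each residue of q modulo 4
-- (and by hand for q = 4).

{-# OPTIONS --safe #-}
module Submission where

open import Data.Nat
open import Data.Nat.Properties
open import Data.Nat.DivMod
open import Data.Nat.Divisibility using (divides-refl)
open import Data.Nat.Tactic.RingSolver using (solve-∀)
open import Data.Bool using (Bool; true; false; if_then_else_; _∧_; _∨_)
open import Data.Empty using (⊥; ⊥-elim)
open import Function using (id)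
open import Data.Fin using (Fin; toℕ)
open import Data.Fin.Properties using (toℕ-fromℕ<; toℕ-injective)
open import Data.Product using (Σ; _×_; _,_; proj₁; proj₂; ∃-syntax)
open import Data.Sum using (_⊎_; inj₁; inj₂; [_,_]′)
open import Data.Vec using (_∷_; []; reverse)
open import Data.Vec.Properties using (∷-injectiveˡ; ∷-injectiveʳ)
open import Relation.Binary using (tri<; tri≈; tri>)
open import Relation.Binary.PropositionalEquality
open import Relation.Nullary using (yes; no; does)
open import Relation.Nullary.Decidable using (dec-true; dec-false; toWitness)
open import Defs

OrientableAboveBound : ℕ → Set
OrientableAboveBound q = ∃[ m ] Σ (NonZero m) λ nz → ∃[ s ] (IsOrientable {q} s 3 m {{nz}} × m ≥ bound q)

[r+k*d]/d≡k : ∀ {d} .{{_ : NonZero d}} r k → r < d → (r + k * d) / d ≡ k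
[r+k*d]/d≡k {d} r k r<d = begin
  (r + k * d) / d        ≡⟨ +-distrib-/-∣ʳ r (divides-refl k) ⟩
  r / d + k * d / d      ≡⟨ cong₂ _+_ (m<n⇒m/n≡0 r<d) (m*n/n≡m k d) ⟩
  k                      ∎
  where open ≡-Reasoning

[r+k*d]%d≡r : ∀ {d} .{{_ : NonZero d}} r k → r < d → (r + k * d) % d ≡ r
[r+k*d]%d≡r {d} r k r<d = trans ([m+kn]%n≡m%n r k d) (m<n⇒m%n≡m r<d)

sum< : (ℕ → ℕ) → ℕ → ℕ
sum< f zero = 0
sum< f (suc n) = sum< f n + f n

sum<-cong : ∀ {f g} n → (∀ k → k < n → f k ≡ g k) → sum< f n ≡ sum< g n
sum<-cong zero e = refl
sum<-cong (suc n) e = cong₂ _+_ (sum<-cong n (λ k k<n → e k (m<n⇒m<1+n k<n))) (e n ≤-refl)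

sum<-suc : ∀ f n → sum< f (suc n) ≡ f 0 + sum< (λ k → f (suc k)) n
sum<-suc f zero = +-comm 0 (f 0)
sum<-suc f (suc n) = trans (cong (_+ f (suc n)) (sum<-suc f n)) (+-assoc (f 0) _ _)

sum<-+ : ∀ f m n → sum< f (m + n) ≡ sum< f m + sum< (λ k → f (m + k)) n
sum<-+ f m zero = trans (cong (sum< f) (+-identityʳ m)) (sym (+-identityʳ _))
sum<-+ f m (suc n) = begin
  sum< f (m + suc n)                                    ≡⟨ cong (sum< f) (+-suc m n) ⟩
  sum< f (m + n) + f (m + n)                            ≡⟨ cong (_+ f (m + n)) (sum<-+ f m n) ⟩
  sum< f m + sum< (λ k → f (m + k)) n + f (m + n)       ≡⟨ +-assoc (sum< f m) _ _ ⟩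
  sum< f m + (sum< (λ k → f (m + k)) n + f (m + n))     ∎
  where open ≡-Reasoning

module Modular (q : ℕ) .{{_ : NonZero q}} where

  infix 4 _≈_
  _≈_ : ℕ → ℕ → Set
  a ≈ b = a % q ≡ b % q

  0<q : 0 < q
  0<q = >-nonZero⁻¹ q

  m%q≈m : ∀ m → m % q ≈ m
  m%q≈m m = m%n%n≡m%n m q

  0%q≡0 : 0 % q ≡ 0
  0%q≡0 = m*n%n≡0 0 q

  q≈0 : q ≈ 0
  q≈0 = trans (n%n≡0 q) (sym 0%q≡0)

  k*q≈0 : ∀ k → k * q ≈ 0
  k*q≈0 k = trans (m*n%n≡0 k q) (sym 0%q≡0)

  m+q≈m : ∀ m → m + q ≈ m
  m+q≈m m = [m+n]%n≡m%n m q

  m+k*q≈m : ∀ m k → m + k * q ≈ m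
  m+k*q≈m m k = [m+kn]%n≡m%n m k q

  ≈⇒≡ : ∀ {a b} → a < q → b < q → a ≈ b → a ≡ b
  ≈⇒≡ a<q b<q e = trans (sym (m<n⇒m%n≡m a<q)) (trans e (m<n⇒m%n≡m b<q))

  +-cong≈ : ∀ {a a′ b b′} → a ≈ a′ → b ≈ b′ → a + b ≈ a′ + b′
  +-cong≈ {a} {a′} {b} {b′} e₁ e₂ = begin
    (a + b) % q              ≡⟨ %-distribˡ-+ a b q ⟩
    (a % q + b % q) % q      ≡⟨ cong₂ (λ x y → (x + y) % q) e₁ e₂ ⟩
    (a′ % q + b′ % q) % q    ≡⟨ %-distribˡ-+ a′ b′ q ⟨
    (a′ + b′) % q            ∎
    where open ≡-Reasoning

  +-congˡ≈ : ∀ {a b} c → a ≈ b → c + a ≈ c + b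
  +-congˡ≈ c = +-cong≈ {c} {c} refl

  +-congʳ≈ : ∀ {a b} c → a ≈ b → a + c ≈ b + c
  +-congʳ≈ c e = +-cong≈ e (refl {x = c % q})

  *-cong≈ : ∀ {a a′ b b′} → a ≈ a′ → b ≈ b′ → a * b ≈ a′ * b′
  *-cong≈ {a} {a′} {b} {b′} e₁ e₂ = begin
    (a * b) % q              ≡⟨ %-distribˡ-* a b q ⟩
    (a % q * (b % q)) % q    ≡⟨ cong₂ (λ x y → (x * y) % q) e₁ e₂ ⟩
    (a′ % q * (b′ % q)) % q  ≡⟨ %-distribˡ-* a′ b′ q ⟨
    (a′ * b′) % q            ∎
    where open ≡-Reasoning

  infixl 6 _⊖_
  _⊖_ : ℕ → ℕ → ℕ
  x ⊖ y = (x + (q ∸ y % q)) % q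

  ⊖<q : ∀ x y → x ⊖ y < q
  ⊖<q x y = m%n<n _ q

  [m⊖n]%q≡m⊖n : ∀ m n → (m ⊖ n) % q ≡ m ⊖ n
  [m⊖n]%q≡m⊖n m n = m<n⇒m%n≡m (⊖<q m n)

  m+n+[q∸n%q]≈m : ∀ m n → m + n + (q ∸ n % q) ≈ m
  m+n+[q∸n%q]≈m m n = begin
    (m + n + (q ∸ n % q)) % q          ≡⟨ cong (_% q) (+-assoc m n _) ⟩
    (m + (n + (q ∸ n % q))) % q        ≡⟨ +-congˡ≈ m (+-congʳ≈ (q ∸ n % q) (sym (m%q≈m n))) ⟩
    (m + (n % q + (q ∸ n % q))) % q    ≡⟨ cong (λ z → (m + z) % q) (m+[n∸m]≡n (m%n≤n n q)) ⟩
    (m + q) % q                        ≡⟨ m+q≈m m ⟩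
    m % q                              ∎
    where open ≡-Reasoning

  +-cancelʳ-≈ : ∀ {a b} c → a + c ≈ b + c → a ≈ b
  +-cancelʳ-≈ {a} {b} c e =
    trans (sym (m+n+[q∸n%q]≈m a c)) (trans (+-congʳ≈ (q ∸ c % q) e) (m+n+[q∸n%q]≈m b c))

  +-cancelˡ-≈ : ∀ {a b} c → c + a ≈ c + b → a ≈ b
  +-cancelˡ-≈ {a} {b} c e = +-cancelʳ-≈ c (trans (cong (_% q) (+-comm a c)) (trans e (cong (_% q) (+-comm c b))))

  m⊖n+n≈m : ∀ m n → m ⊖ n + n ≈ m
  m⊖n+n≈m m n = begin
    ((m + (q ∸ n % q)) % q + n) % q    ≡⟨ +-congʳ≈ n (m%q≈m _) ⟩
    (m + (q ∸ n % q) + n) % q          ≡⟨ cong (_% q) (+-assoc m _ n) ⟩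
    (m + ((q ∸ n % q) + n)) % q        ≡⟨ cong (λ z → (m + z) % q) (+-comm _ n) ⟩
    (m + (n + (q ∸ n % q))) % q        ≡⟨ cong (_% q) (+-assoc m n _) ⟨
    (m + n + (q ∸ n % q)) % q          ≡⟨ m+n+[q∸n%q]≈m m n ⟩
    m % q                              ∎
    where open ≡-Reasoning

  ⊖-unique : ∀ {x y z} → z < q → x ≈ y + z → x ⊖ y ≡ z
  ⊖-unique {x} {y} {z} z<q e = ≈⇒≡ (⊖<q x y) z<q
    (+-cancelʳ-≈ y (trans (m⊖n+n≈m x y) (trans e (cong (_% q) (+-comm y z)))))

  m+n≡o⇒o⊖m≡n : ∀ {m n o} → m + n ≡ o → n < q → o ⊖ m ≡ n
  m+n≡o⇒o⊖m≡n e n<q = ⊖-unique n<q (cong (_% q) (sym e))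

  ⊖-sumˡ : ∀ x X → (x % q + (X ⊖ x) % q) % q ≡ X % q
  ⊖-sumˡ x X = trans (sym (%-distribˡ-+ x (X ⊖ x) q)) (trans (cong (_% q) (+-comm x (X ⊖ x))) (m⊖n+n≈m X x))

  ⊖-sumʳ : ∀ x X → ((X ⊖ x) % q + x % q) % q ≡ X % q
  ⊖-sumʳ x X = trans (sym (%-distribˡ-+ (X ⊖ x) x q)) (m⊖n+n≈m X x)

  ⊖-sum-suc : ∀ x X → ((X ⊖ x) % q + suc x % q) % q ≡ suc X % q
  ⊖-sum-suc x X = trans (sym (%-distribˡ-+ (X ⊖ x) (suc x) q))
    (trans (cong (_% q) (+-suc (X ⊖ x) x)) (+-congˡ≈ 1 (m⊖n+n≈m X x)))

  [1+2K]⊖[1+j]≡2K∸j : ∀ {K j} → j < K → K * 2 < q → suc (K * 2) ⊖ (1 + j) ≡ K * 2 ∸ j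
  [1+2K]⊖[1+j]≡2K∸j {K} {j} j<K 2K<q =
    m+n≡o⇒o⊖m≡n (cong suc (m+[n∸m]≡n (≤-trans (<⇒≤ j<K) (m≤m*n K 2)))) (≤-<-trans (m∸n≤m (K * 2) j) 2K<q)

  K≤[1+2K]⊖[1+j]⊖1 : ∀ {K j} → j < K → K * 2 < q → K ≤ suc (K * 2) ⊖ (1 + j) ⊖ 1
  K≤[1+2K]⊖[1+j]⊖1 {K} {j} j<K 2K<q rewrite [1+2K]⊖[1+j]≡2K∸j j<K 2K<q =
    subst (K ≤_) (sym (m+n≡o⇒o⊖m≡n (sym (+-∸-assoc 1 (≤-trans j<K (m≤m*n K 2)))) (≤-<-trans (m∸n≤m (K * 2) (suc j)) 2K<q)))
      (subst (_≤ K * 2 ∸ suc j) (m+n∸n≡m K (suc j)) (∸-monoˡ-≤ (suc j) (≤-trans (+-monoʳ-≤ K j<K) (≤-reflexive (double K)))))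
    where
    double : ∀ K → K + K ≡ K * 2
    double = solve-∀

  *-cancelʳ-unit : ∀ {a b w w′} → w * w′ ≈ 1 → a * w ≈ b * w → a ≈ b
  *-cancelʳ-unit {a} {b} {w} {w′} ww′≈1 e = begin
    a % q                ≡⟨ cong (_% q) (*-identityʳ a) ⟨
    (a * 1) % q          ≡⟨ *-cong≈ {a} refl (sym ww′≈1) ⟩
    (a * (w * w′)) % q   ≡⟨ cong (_% q) (*-assoc a w w′) ⟨
    (a * w * w′) % q     ≡⟨ *-cong≈ e (refl {x = w′ % q}) ⟩
    (b * w * w′) % q     ≡⟨ cong (_% q) (*-assoc b w w′) ⟩
    (b * (w * w′)) % q   ≡⟨ *-cong≈ {b} refl ww′≈1 ⟩
    (b * 1) % q          ≡⟨ cong (_% q) (*-identityʳ b) ⟩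
    b % q                ∎
    where open ≡-Reasoning

  m+1≈0⇒m*[q∸1]≈1 : ∀ m → m + 1 ≈ 0 → m * (q ∸ 1) ≈ 1
  m+1≈0⇒m*[q∸1]≈1 m e = +-cancelʳ-≈ (q ∸ 1) (begin
    (m * (q ∸ 1) + (q ∸ 1)) % q    ≡⟨ cong (_% q) (lemma m (q ∸ 1)) ⟩
    ((m + 1) * (q ∸ 1)) % q        ≡⟨ *-cong≈ e (refl {x = (q ∸ 1) % q}) ⟩
    0 % q                          ≡⟨ q≈0 ⟨
    q % q                          ≡⟨ cong (_% q) (m+[n∸m]≡n 0<q) ⟨
    (1 + (q ∸ 1)) % q              ∎)
    where
    open ≡-Reasoning
    lemma : ∀ m x → m * x + x ≡ (m + 1) * x
    lemma = solve-∀

  ≈0⇒≡q : ∀ {x y} → x < q → y < q → 0 < x → x + y ≈ 0 → x + y ≡ q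
  ≈0⇒≡q {x} {y} x<q y<q 0<x e with <-cmp (x + y) q
  ... | tri< lt _ _ = ⊥-elim (<⇒≢ (<-≤-trans 0<x (m≤m+n x y)) (sym (trans (sym (m<n⇒m%n≡m lt)) (trans e 0%q≡0))))
  ... | tri≈ _ eq _ = eq
  ... | tri> _ _ gt = ⊥-elim (<⇒≢ (m<n⇒0<n∸m gt)
    (sym (trans (sym (m<n⇒m%n≡m x+y∸q<q)) (trans (m≤n⇒[n∸m]%m≡n%m (<⇒≤ gt)) (trans e 0%q≡0)))))
    where
    x+y∸q<q : x + y ∸ q < q
    x+y∸q<q = subst (x + y ∸ q <_) (m+n∸n≡m q q) (∸-monoˡ-< (+-mono-< x<q y<q) (<⇒≤ gt))

  sum<-telescope : ∀ (f P : ℕ → ℕ) n → P 0 ≈ 0 → (∀ p → p < n → P (suc p) ≈ P p + f p) → sum< f n ≈ P n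
  sum<-telescope f P zero P0 step = sym P0
  sum<-telescope f P (suc n) P0 step =
    trans (+-congʳ≈ (f n) (sum<-telescope f P n P0 (λ p p<n → step p (m<n⇒m<1+n p<n)))) (sym (step n ≤-refl))

module Walks (q : ℕ) .{{_ : NonZero q}} where
  open Modular q public

  -- Vertices are read modulo q.  D recovers the position of each arc, so the arcs of the walk are pairwise distinct.
  record ClosedWalk (G : ℕ → ℕ → Set) : Set where
    field
      L : ℕ
      f : ℕ → ℕ
      closes : f L ≈ f 0
      arc∈G : ∀ p → p < L → G (f p % q) (f (suc p) % q)
      D : ℕ → ℕ → ℕ
      D-arc : ∀ p → p < L → D (f p % q) (f (suc p) % q) ≡ p

  weight : ∀ {G} → ClosedWalk G → ℕ
  weight W = sum< f L
    where open ClosedWalk W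

  -- No arc of G is the negated reverse (−b, −a) of an arc (a, b) of G: a closed walk with arcs in G
  -- is a negative orientable sequence of order 2.
  NegReverseFree : (ℕ → ℕ → Set) → Set
  NegReverseFree G = ∀ a b a′ b′ → a < q → b < q → a′ < q → b′ < q →
                     G a b → G a′ b′ → a + b′ ≈ 0 → b + a′ ≈ 0 → ⊥

  neg-reverse-sums : ∀ a b a′ b′ → a + b′ ≈ 0 → b + a′ ≈ 0 → (a + b) % q + (a′ + b′) % q ≈ 0
  neg-reverse-sums a b a′ b′ e₁ e₂ = begin
    ((a + b) % q + (a′ + b′) % q) % q    ≡⟨ +-cong≈ (m%q≈m (a + b)) (m%q≈m (a′ + b′)) ⟩
    ((a + b) + (a′ + b′)) % q            ≡⟨ cong (_% q) (lemma a b a′ b′) ⟩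
    ((a + b′) + (b + a′)) % q            ≡⟨ +-cong≈ e₁ e₂ ⟩
    0 % q                                ∎
    where
    open ≡-Reasoning
    lemma : ∀ a b a′ b′ → (a + b) + (a′ + b′) ≡ (a + b′) + (b + a′)
    lemma = solve-∀

  neg-reverse-tail : ∀ a b a′ → a < q → b + a′ ≈ 0 → (a′ + (a + b) % q) % q ≡ a
  neg-reverse-tail a b a′ a<q e = begin
    (a′ + (a + b) % q) % q     ≡⟨ +-congˡ≈ a′ (m%q≈m (a + b)) ⟩
    (a′ + (a + b)) % q         ≡⟨ cong (_% q) (lemma a b a′) ⟩
    (a + (b + a′)) % q         ≡⟨ +-congˡ≈ a e ⟩
    (a + 0) % q                ≡⟨ cong (_% q) (+-identityʳ a) ⟩
    a % q                      ≡⟨ m<n⇒m%n≡m a<q ⟩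
    a                          ∎
    where
    open ≡-Reasoning
    lemma : ∀ a b a′ → a′ + (a + b) ≡ a + (b + a′)
    lemma = solve-∀

  neg-reverse-shift : ∀ {a b a′ c} → a < q → b + a′ ≈ 0 → (a + b) % q ≡ c → a′ + c < q → a′ + c ≡ a
  neg-reverse-shift {a} {b} {a′} {c} a<q e s≡c a′+c<q =
    trans (sym (m<n⇒m%n≡m a′+c<q)) (trans (cong (λ z → (a′ + z) % q) (sym s≡c)) (neg-reverse-tail a b a′ a<q e))

  neg-reverse-≥ : ∀ {a b a′ c} → a < q → 0 < a → b + a′ ≈ 0 → (a + b) % q ≡ c → a′ + c ≤ q → c ≤ a
  neg-reverse-≥ {a} {b} {a′} {c} a<q 0<a e s≡c a′+c≤q with m≤n⇒m<n∨m≡n a′+c≤q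
  ... | inj₁ a′+c<q = subst (c ≤_) (neg-reverse-shift a<q e s≡c a′+c<q) (m≤n+m c a′)
  ... | inj₂ a′+c≡q = ⊥-elim (<⇒≢ 0<a (sym (trans (sym (neg-reverse-tail a b a′ a<q e))
                        (trans (cong (λ z → (a′ + z) % q) s≡c) (trans (cong (_% q) a′+c≡q) (trans q≈0 0%q≡0))))))

  module Lift {G : ℕ → ℕ → Set} (W : ClosedWalk G) (L>0 : 0 < ClosedWalk.L W) where
    open ClosedWalk W

    instance
      L≢0 : NonZero L
      L≢0 = >-nonZero L>0
      qL≢0 : NonZero (q * L)
      qL≢0 = m*n≢0 q L

    t : ℕ → ℕ
    t i = f (i % L)

    S : ℕ → ℕ
    S = sum< t

    s : ℕ → Fin q
    s i = S i mod q

    t-periodic : ∀ r a → t (r + a * L) ≡ t r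
    t-periodic r a = cong f ([m+kn]%n≡m%n r a L)

    t≈f : ∀ p → p ≤ L → t p ≈ f p
    t≈f p p≤L with m≤n⇒m<n∨m≡n p≤L
    ... | inj₁ p<L = cong (λ x → f x % q) (m<n⇒m%n≡m p<L)
    ... | inj₂ refl = trans (cong (λ x → f x % q) (n%n≡0 L)) (sym closes)

    t-suc : ∀ i → t (suc i) ≈ f (suc (i % L))
    t-suc i = begin
      t (suc i) % q                      ≡⟨ cong (λ x → t (suc x) % q) (m≡m%n+[m/n]*n i L) ⟩
      t (suc (i % L) + i / L * L) % q    ≡⟨ cong (_% q) (t-periodic (suc (i % L)) (i / L)) ⟩
      t (suc (i % L)) % q                ≡⟨ t≈f (suc (i % L)) (m%n<n i L) ⟩
      f (suc (i % L)) % q                ∎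
      where open ≡-Reasoning

    t-arc∈G : ∀ i → G (t i % q) (t (suc i) % q)
    t-arc∈G i = subst (G (t i % q)) (sym (t-suc i)) (arc∈G (i % L) (m%n<n i L))

    D-t : ∀ i → D (t i % q) (t (suc i) % q) ≡ i % L
    D-t i = trans (cong (D (t i % q)) (t-suc i)) (D-arc (i % L) (m%n<n i L))

    S-L : S L ≡ weight W
    S-L = sum<-cong L (λ k k<L → cong f (m<n⇒m%n≡m k<L))

    S-shift : ∀ x → S (L + x) ≡ S L + S x
    S-shift x = trans (sum<-+ t L x) (cong (S L +_) (sum<-cong x (λ k _ → cong f (%-periodic k))))
      where
      %-periodic : ∀ k → (L + k) % L ≡ k % L
      %-periodic k = trans (cong (_% L) (+-comm L k)) ([m+n]%n≡m%n k L)

    S-periods : ∀ a r → S (a * L + r) ≡ a * S L + S r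
    S-periods zero r = refl
    S-periods (suc a) r = begin
      S (L + a * L + r)        ≡⟨ cong S (+-assoc L (a * L) r) ⟩
      S (L + (a * L + r))      ≡⟨ S-shift (a * L + r) ⟩
      S L + S (a * L + r)      ≡⟨ cong (S L +_) (S-periods a r) ⟩
      S L + (a * S L + S r)    ≡⟨ +-assoc (S L) (a * S L) (S r) ⟨
      S L + a * S L + S r      ∎
      where open ≡-Reasoning

    S-div-mod : ∀ i → S i ≡ i / L * S L + S (i % L)
    S-div-mod i = trans (cong S (trans (m≡m%n+[m/n]*n i L) (+-comm (i % L) _))) (S-periods (i / L) (i % L))

    toℕ-s : ∀ i → toℕ (s i) ≡ S i % q
    toℕ-s i = toℕ-fromℕ< (m%n<n (S i) q)

    s≡⇒S≈ : ∀ i j → s i ≡ s j → S i ≈ S j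
    s≡⇒S≈ i j e = trans (sym (toℕ-s i)) (trans (cong toℕ e) (toℕ-s j))

    S≈⇒s≡ : ∀ i j → S i ≈ S j → s i ≡ s j
    S≈⇒s≡ i j e = toℕ-injective (trans (toℕ-s i) (trans e (sym (toℕ-s j))))

    periodic : IsPeriodic s (q * L)
    periodic i = S≈⇒s≡ (i + q * L) i (begin
      S (i + q * L) % q         ≡⟨ cong (λ x → S x % q) (+-comm i (q * L)) ⟩
      S (q * L + i) % q         ≡⟨ cong (_% q) (S-periods q i) ⟩
      (q * S L + S i) % q       ≡⟨ cong (_% q) (+-comm (q * S L) (S i)) ⟩
      (S i + q * S L) % q       ≡⟨ cong (λ x → (S i + x) % q) (*-comm q (S L)) ⟩
      (S i + S L * q) % q       ≡⟨ m+k*q≈m (S i) (S L) ⟩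
      S i % q                   ∎)
      where open ≡-Reasoning

    window₃ : ∀ i → window s 3 i ≡ s i ∷ s (1 + i) ∷ s (2 + i) ∷ []
    window₃ i rewrite +-identityʳ i | +-comm i 1 | +-comm i 2 = refl

    Δ-cancel : ∀ {x y} → S x ≈ S y → S (suc x) ≈ S (suc y) → t x ≈ t y
    Δ-cancel {x} {y} e₀ e₁ = +-cancelˡ-≈ (S x) (trans e₁ (+-congʳ≈ (t y) (sym e₀)))

    Δ-negated : ∀ {x y} → S x ≈ S (2 + y) → S (suc x) ≈ S (suc y) → t x + t (suc y) ≈ 0
    Δ-negated {x} {y} e₀ e₁ = +-cancelˡ-≈ (S x) (begin
      (S x + (t x + t (suc y))) % q    ≡⟨ cong (_% q) (+-assoc (S x) (t x) (t (suc y))) ⟨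
      (S (suc x) + t (suc y)) % q      ≡⟨ +-congʳ≈ (t (suc y)) e₁ ⟩
      S (2 + y) % q                    ≡⟨ e₀ ⟨
      S x % q                          ≡⟨ cong (_% q) (+-identityʳ (S x)) ⟨
      (S x + 0) % q                    ∎)
      where open ≡-Reasoning

    %-q*L : ∀ i → i % (q * L) ≡ i / L % q * L + i % L
    %-q*L i = begin
      i % (q * L)                        ≡⟨ cong (_% (q * L)) (trans (m≡m%n+[m/n]*n i L) (+-comm (i % L) _)) ⟩
      (i / L * L + i % L) % (q * L)      ≡⟨ [m*n+o]%[p*n]≡[m*n]%[p*n]+o (i / L) q (m%n<n i L) ⟩
      i / L * L % (q * L) + i % L        ≡⟨ cong (_+ i % L) (m%n*o≡m*o%[n*o] (i / L) q L) ⟨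
      i / L % q * L + i % L              ∎
      where open ≡-Reasoning

    module _ (w′ : ℕ) (unit : weight W * w′ ≈ 1) where

      windows-injective : IsWindowSeq s 3 (q * L)
      windows-injective i j e = begin
        i % (q * L)               ≡⟨ %-q*L i ⟩
        i / L % q * L + i % L     ≡⟨ cong₂ (λ a r → a * L + r) same-period same-position ⟩
        j / L % q * L + j % L     ≡⟨ %-q*L j ⟨
        j % (q * L)               ∎
        where
        open ≡-Reasoning
        e′ = trans (sym (window₃ i)) (trans e (window₃ j))
        S₀ = s≡⇒S≈ i j (∷-injectiveˡ e′)
        S₁ = s≡⇒S≈ (1 + i) (1 + j) (∷-injectiveˡ (∷-injectiveʳ e′))
        S₂ = s≡⇒S≈ (2 + i) (2 + j) (∷-injectiveˡ (∷-injectiveʳ (∷-injectiveʳ e′)))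
        same-position : i % L ≡ j % L
        same-position = trans (sym (D-t i)) (trans (cong₂ D (Δ-cancel S₀ S₁) (Δ-cancel S₁ S₂)) (D-t j))
        same-period : i / L ≈ j / L
        same-period = *-cancelʳ-unit {i / L} {j / L} (trans (cong (λ w → (w * w′) % q) S-L) unit)
          (+-cancelʳ-≈ (S (i % L)) (begin
            (i / L * S L + S (i % L)) % q    ≡⟨ cong (_% q) (S-div-mod i) ⟨
            S i % q                          ≡⟨ S₀ ⟩
            S j % q                          ≡⟨ cong (_% q) (S-div-mod j) ⟩
            (j / L * S L + S (j % L)) % q    ≡⟨ cong (λ r → (j / L * S L + S r) % q) same-position ⟨
            (j / L * S L + S (i % L)) % q    ∎))

      windows-not-reversed : NegReverseFree G → ∀ i j → window s 3 i ≢ reverse (window s 3 j)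
      windows-not-reversed free i j e =
        free (t i % q) (t (suc i) % q) (t j % q) (t (suc j) % q) (m%n<n _ q) (m%n<n _ q) (m%n<n _ q) (m%n<n _ q)
             (t-arc∈G i) (t-arc∈G j)
             (residues (Δ-negated S₀ S₁))
             (residues (trans (cong (_% q) (+-comm (t (suc i)) (t j))) (Δ-negated (sym S₂) (sym S₁))))
        where
        e′ = trans (sym (window₃ i)) (trans e (cong reverse (window₃ j)))
        S₀ = s≡⇒S≈ i (2 + j) (∷-injectiveˡ e′)
        S₁ = s≡⇒S≈ (1 + i) (1 + j) (∷-injectiveˡ (∷-injectiveʳ e′))
        S₂ = s≡⇒S≈ (2 + i) j (∷-injectiveˡ (∷-injectiveʳ (∷-injectiveʳ e′)))
        residues : ∀ {x y} → x + y ≈ 0 → x % q + y % q ≈ 0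
        residues = trans (+-cong≈ (m%q≈m _) (m%q≈m _))

      lift-orientable : NegReverseFree G → IsOrientable s 3 (q * L)
      lift-orientable free = periodic , windows-injective , windows-not-reversed free

  orientable-from-walk : ∀ {G} (W : ClosedWalk G) → NegReverseFree G → (L>0 : 0 < ClosedWalk.L W) →
    ∀ w′ → weight W * w′ ≈ 1 → bound q ≤ q * ClosedWalk.L W → OrientableAboveBound q
  orientable-from-walk W free L>0 w′ unit long =
    q * L , m*n≢0 q L , s , lift-orientable w′ unit free , long
    where
    open ClosedWalk W
    open Lift W L>0

  record ArcOf {G : ℕ → ℕ → Set} (W : ClosedWalk G) (f′ : ℕ → ℕ) (p p′ : ℕ) : Set where
    field
      p′<L : p′ < ClosedWalk.L W
      head : f′ p ≈ ClosedWalk.f W p′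
      tail : f′ (suc p) ≈ ClosedWalk.f W (suc p′)

  module _ {G : ℕ → ℕ → Set} {W : ClosedWalk G} {f′ : ℕ → ℕ} {p p′ : ℕ} (arc : ArcOf W f′ p p′) where
    open ClosedWalk W
    open ArcOf arc

    ArcOf-∈G : G (f′ p % q) (f′ (suc p) % q)
    ArcOf-∈G = subst₂ G (sym head) (sym tail) (arc∈G p′ p′<L)

    ArcOf-D : (D′ : ℕ → ℕ → ℕ) → D′ (f′ p % q) (f′ (suc p) % q) ≡ D′ (f p′ % q) (f (suc p′) % q)
    ArcOf-D D′ = cong₂ D′ head tail

  AllArcs : ∀ {G} → ClosedWalk G → (ℕ → ℕ → Bool) → Bool → Set
  AllArcs W test b = ∀ p → p < L → test (f p % q) (f (suc p) % q) ≡ b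
    where open ClosedWalk W

  -- Inserts W₂ into W₁ at position p₁, where W₁ passes the start of W₂; inW₂ tells the arcs of W₂ from those of W₁.
  module Splice {G : ℕ → ℕ → Set} (W₁ W₂ : ClosedWalk G) (p₁ : ℕ) (inW₂ : ℕ → ℕ → Bool)
    (p₁≤L₁ : p₁ ≤ ClosedWalk.L W₁) (start : ClosedWalk.f W₂ 0 ≈ ClosedWalk.f W₁ p₁)
    (arcs₂ : AllArcs W₂ inW₂ true) (arcs₁ : AllArcs W₁ inW₂ false) where
    open ClosedWalk W₁ using () renaming (L to L₁; f to f₁; D to D₁; closes to closes₁; D-arc to D-arc₁)
    open ClosedWalk W₂ using () renaming (L to L₂; f to f₂; D to D₂; closes to closes₂; D-arc to D-arc₂)

    L′ : ℕ
    L′ = L₁ + L₂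

    f′ : ℕ → ℕ
    f′ p = if does (p <? p₁) then f₁ p else if does (p <? p₁ + L₂) then f₂ (p ∸ p₁) else f₁ (p ∸ L₂)

    shift : ℕ → ℕ
    shift p = if does (p <? p₁) then p else p + L₂

    D′ : ℕ → ℕ → ℕ
    D′ a b = if inW₂ a b then p₁ + D₂ a b else shift (D₁ a b)

    f′-before : ∀ p → p < p₁ → f′ p ≡ f₁ p
    f′-before p p<p₁ rewrite dec-true (p <? p₁) p<p₁ = refl

    f′-inside : ∀ k → k < L₂ → f′ (p₁ + k) ≡ f₂ k
    f′-inside k k<L₂
      rewrite dec-false (p₁ + k <? p₁) (≤⇒≯ (m≤m+n p₁ k))
            | dec-true (p₁ + k <? p₁ + L₂) (+-monoʳ-< p₁ k<L₂) = cong f₂ (m+n∸m≡n p₁ k)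

    f′-after : ∀ p → p₁ ≤ p → f′ (p + L₂) ≡ f₁ p
    f′-after p p₁≤p
      rewrite dec-false (p + L₂ <? p₁) (≤⇒≯ (≤-trans p₁≤p (m≤m+n p L₂)))
            | dec-false (p + L₂ <? p₁ + L₂) (≤⇒≯ (+-monoˡ-≤ L₂ p₁≤p)) = cong f₁ (m+n∸n≡m p L₂)

    f′-p₁ : f′ p₁ ≈ f₁ p₁
    f′-p₁ with m≤n⇒m<n∨m≡n (z≤n {L₂})
    ... | inj₁ 0<L₂ = trans (cong (λ p → f′ p % q) (sym (+-identityʳ p₁))) (trans (cong (_% q) (f′-inside 0 0<L₂)) start)
    ... | inj₂ 0≡L₂ = cong (_% q) (trans (cong f′ (trans (sym (+-identityʳ p₁)) (cong (p₁ +_) 0≡L₂))) (f′-after p₁ ≤-refl))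

    arc-before : ∀ p → p < p₁ → ArcOf W₁ f′ p p
    arc-before p p<p₁ = record { p′<L = <-≤-trans p<p₁ p₁≤L₁ ; head = cong (_% q) (f′-before p p<p₁) ; tail = tail }
      where
      tail : f′ (suc p) ≈ f₁ (suc p)
      tail with m≤n⇒m<n∨m≡n p<p₁
      ... | inj₁ 1+p<p₁ = cong (_% q) (f′-before (suc p) 1+p<p₁)
      ... | inj₂ refl = f′-p₁

    arc-inside : ∀ k → k < L₂ → ArcOf W₂ f′ (p₁ + k) k
    arc-inside k k<L₂ = record { p′<L = k<L₂ ; head = cong (_% q) (f′-inside k k<L₂) ; tail = tail }
      where
      tail : f′ (suc (p₁ + k)) ≈ f₂ (suc k)
      tail rewrite sym (+-suc p₁ k) with m≤n⇒m<n∨m≡n k<L₂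
      ... | inj₁ 1+k<L₂ = cong (_% q) (f′-inside (suc k) 1+k<L₂)
      ... | inj₂ refl = trans (cong (_% q) (f′-after p₁ ≤-refl)) (trans (sym start) (sym closes₂))

    arc-after : ∀ p → p₁ ≤ p → p < L₁ → ArcOf W₁ f′ (p + L₂) p
    arc-after p p₁≤p p<L₁ = record
      { p′<L = p<L₁
      ; head = cong (_% q) (f′-after p p₁≤p)
      ; tail = cong (_% q) (f′-after (suc p) (m≤n⇒m≤1+n p₁≤p))
      }

    data Position : ℕ → Set where
      before : ∀ p → p < p₁ → Position p
      inside : ∀ k → k < L₂ → Position (p₁ + k)
      after  : ∀ p → p₁ ≤ p → p < L₁ → Position (p + L₂)

    position : ∀ p → p < L′ → Position p
    position p p<L′ with p <? p₁ | p <? p₁ + L₂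
    ... | yes p<p₁ | _ = before p p<p₁
    ... | no p≮p₁ | yes p<p₁+L₂ = subst Position (m+[n∸m]≡n p₁≤p)
          (inside (p ∸ p₁) (subst (p ∸ p₁ <_) (m+n∸m≡n p₁ L₂) (∸-monoˡ-< p<p₁+L₂ p₁≤p)))
      where p₁≤p = ≮⇒≥ p≮p₁
    ... | no _ | no p≮p₁+L₂ = subst Position (m∸n+n≡m (≤-trans (m≤n+m L₂ p₁) p₁+L₂≤p))
          (after (p ∸ L₂) (subst (_≤ p ∸ L₂) (m+n∸n≡m p₁ L₂) (∸-monoˡ-≤ L₂ p₁+L₂≤p))
                 (subst (p ∸ L₂ <_) (m+n∸n≡m L₁ L₂) (∸-monoˡ-< p<L′ (≤-trans (m≤n+m L₂ p₁) p₁+L₂≤p))))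
      where p₁+L₂≤p = ≮⇒≥ p≮p₁+L₂

    D′-arc₁ : ∀ p → p < L₁ → D′ (f₁ p % q) (f₁ (suc p) % q) ≡ shift p
    D′-arc₁ p p<L₁ rewrite arcs₁ p p<L₁ = cong shift (D-arc₁ p p<L₁)

    D′-arc₂ : ∀ k → k < L₂ → D′ (f₂ k % q) (f₂ (suc k) % q) ≡ p₁ + k
    D′-arc₂ k k<L₂ rewrite arcs₂ k k<L₂ = cong (p₁ +_) (D-arc₂ k k<L₂)

    arc∈G′ : ∀ p → p < L′ → G (f′ p % q) (f′ (suc p) % q)
    arc∈G′ p p<L′ = go (position p p<L′)
      where
      go : ∀ {p} → Position p → G (f′ p % q) (f′ (suc p) % q)
      go (before p p<p₁) = ArcOf-∈G (arc-before p p<p₁)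
      go (inside k k<L₂) = ArcOf-∈G (arc-inside k k<L₂)
      go (after p p₁≤p p<L₁) = ArcOf-∈G (arc-after p p₁≤p p<L₁)

    D′-arc : ∀ p → p < L′ → D′ (f′ p % q) (f′ (suc p) % q) ≡ p
    D′-arc p p<L′ = go (position p p<L′)
      where
      go : ∀ {p} → Position p → D′ (f′ p % q) (f′ (suc p) % q) ≡ p
      go (before p p<p₁) = trans (ArcOf-D (arc-before p p<p₁) D′)
        (trans (D′-arc₁ p (<-≤-trans p<p₁ p₁≤L₁)) (cong (λ b → if b then p else p + L₂) (dec-true (p <? p₁) p<p₁)))
      go (inside k k<L₂) = trans (ArcOf-D (arc-inside k k<L₂) D′) (D′-arc₂ k k<L₂)
      go (after p p₁≤p p<L₁) = trans (ArcOf-D (arc-after p p₁≤p p<L₁) D′)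
        (trans (D′-arc₁ p p<L₁) (cong (λ b → if b then p else p + L₂) (dec-false (p <? p₁) (≤⇒≯ p₁≤p))))

    closes′ : f′ L′ ≈ f′ 0
    closes′ = trans (cong (_% q) (f′-after L₁ p₁≤L₁)) (trans closes₁ (sym f′0))
      where
      f′0 : f′ 0 ≈ f₁ 0
      f′0 with m≤n⇒m<n∨m≡n (z≤n {p₁})
      ... | inj₁ 0<p₁ = cong (_% q) (f′-before 0 0<p₁)
      ... | inj₂ 0≡p₁ = subst (λ x → f′ x ≈ f₁ x) (sym 0≡p₁) f′-p₁

    spliced : ClosedWalk G
    spliced = record { L = L′ ; f = f′ ; closes = closes′ ; arc∈G = arc∈G′ ; D = D′ ; D-arc = D′-arc }

    weight-spliced : weight spliced ≡ weight W₁ + weight W₂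
    weight-spliced = begin
      sum< f′ (L₁ + L₂)                                                   ≡⟨ cong (sum< f′) L₁+L₂≡ ⟩
      sum< f′ (p₁ + (L₂ + r))                                             ≡⟨ sum<-+ f′ p₁ (L₂ + r) ⟩
      sum< f′ p₁ + sum< (λ k → f′ (p₁ + k)) (L₂ + r)
        ≡⟨ cong (sum< f′ p₁ +_) (sum<-+ (λ k → f′ (p₁ + k)) L₂ r) ⟩
      sum< f′ p₁ + (sum< (λ k → f′ (p₁ + k)) L₂ + sum< (λ k → f′ (p₁ + (L₂ + k))) r)
        ≡⟨ cong₂ _+_ (sum<-cong p₁ f′-before) (cong₂ _+_ (sum<-cong L₂ f′-inside) (sum<-cong r f′-tail)) ⟩
      sum< f₁ p₁ + (sum< f₂ L₂ + sum< (λ k → f₁ (p₁ + k)) r)              ≡⟨ swap (sum< f₁ p₁) (sum< f₂ L₂) _ ⟩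
      (sum< f₁ p₁ + sum< (λ k → f₁ (p₁ + k)) r) + sum< f₂ L₂              ≡⟨ cong (_+ sum< f₂ L₂) (sum<-+ f₁ p₁ r) ⟨
      sum< f₁ (p₁ + r) + sum< f₂ L₂
        ≡⟨ cong (λ x → sum< f₁ x + sum< f₂ L₂) (m+[n∸m]≡n p₁≤L₁) ⟩
      sum< f₁ L₁ + sum< f₂ L₂                                             ∎
      where
      open ≡-Reasoning
      r = L₁ ∸ p₁
      swap : ∀ a b c → a + (b + c) ≡ a + c + b
      swap = solve-∀
      L₁+L₂≡ : L₁ + L₂ ≡ p₁ + (L₂ + r)
      L₁+L₂≡ = trans (cong (_+ L₂) (sym (m+[n∸m]≡n p₁≤L₁))) (trans (+-assoc p₁ r L₂) (cong (p₁ +_) (+-comm r L₂)))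
      f′-tail : ∀ k → k < r → f′ (p₁ + (L₂ + k)) ≡ f₁ (p₁ + k)
      f′-tail k _ = trans (cong f′ (trans (cong (p₁ +_) (+-comm L₂ k)) (sym (+-assoc p₁ k L₂))))
                          (f′-after (p₁ + k) (m≤m+n p₁ k))

  module RemoveLoop {G : ℕ → ℕ → Set} (W : ClosedWalk G) (p₀ : ℕ) (p₀<L : p₀ < ClosedWalk.L W)
    (loop : ClosedWalk.f W p₀ ≈ ClosedWalk.f W (suc p₀)) where
    open ClosedWalk W

    L′ : ℕ
    L′ = L ∸ 1

    f′ : ℕ → ℕ
    f′ p = if does (p <? p₀) then f p else f (suc p)

    D′ : ℕ → ℕ → ℕ
    D′ a b = if does (D a b <? p₀) then D a b else D a b ∸ 1

    L≡1+L′ : L ≡ suc L′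
    L≡1+L′ = sym (m+[n∸m]≡n (<-≤-trans z<s p₀<L))

    p₀≤L′ : p₀ ≤ L′
    p₀≤L′ = ≤-pred (subst (p₀ <_) L≡1+L′ p₀<L)

    f′-before : ∀ p → p < p₀ → f′ p ≡ f p
    f′-before p p<p₀ rewrite dec-true (p <? p₀) p<p₀ = refl

    f′-from : ∀ p → p₀ ≤ p → f′ p ≡ f (suc p)
    f′-from p p₀≤p rewrite dec-false (p <? p₀) (≤⇒≯ p₀≤p) = refl

    f′≈f : ∀ p → p ≤ p₀ → f′ p ≈ f p
    f′≈f p p≤p₀ with m≤n⇒m<n∨m≡n p≤p₀
    ... | inj₁ p<p₀ = cong (_% q) (f′-before p p<p₀)
    ... | inj₂ refl = trans (cong (_% q) (f′-from p ≤-refl)) (sym loop)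

    arc-before : ∀ p → p < p₀ → ArcOf W f′ p p
    arc-before p p<p₀ = record
      { p′<L = <-trans p<p₀ p₀<L ; head = cong (_% q) (f′-before p p<p₀) ; tail = f′≈f (suc p) p<p₀ }

    arc-from : ∀ p → p₀ ≤ p → p < L′ → ArcOf W f′ p (suc p)
    arc-from p p₀≤p p<L′ = record
      { p′<L = subst (suc p <_) (sym L≡1+L′) (s≤s p<L′)
      ; head = cong (_% q) (f′-from p p₀≤p)
      ; tail = cong (_% q) (f′-from (suc p) (m≤n⇒m≤1+n p₀≤p))
      }

    arc∈G′ : ∀ p → p < L′ → G (f′ p % q) (f′ (suc p) % q)
    arc∈G′ p p<L′ with p <? p₀
    ... | yes p<p₀ = ArcOf-∈G (arc-before p p<p₀)
    ... | no p≮p₀ = ArcOf-∈G (arc-from p (≮⇒≥ p≮p₀) p<L′)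

    D′-arc : ∀ p → p < L′ → D′ (f′ p % q) (f′ (suc p) % q) ≡ p
    D′-arc p p<L′ with p <? p₀
    ... | yes p<p₀ = begin
      D′ (f′ p % q) (f′ (suc p) % q)              ≡⟨ ArcOf-D (arc-before p p<p₀) D′ ⟩
      D′ (f p % q) (f (suc p) % q)
        ≡⟨ cong (λ d → if does (d <? p₀) then d else d ∸ 1) (D-arc p (<-trans p<p₀ p₀<L)) ⟩
      (if does (p <? p₀) then p else p ∸ 1)       ≡⟨ cong (λ b → if b then p else p ∸ 1) (dec-true (p <? p₀) p<p₀) ⟩
      p                                           ∎
      where open ≡-Reasoning
    ... | no p≮p₀ = begin
      D′ (f′ p % q) (f′ (suc p) % q)              ≡⟨ ArcOf-D arc D′ ⟩
      D′ (f (suc p) % q) (f (suc (suc p)) % q)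
        ≡⟨ cong (λ d → if does (d <? p₀) then d else d ∸ 1) (D-arc (suc p) (ArcOf.p′<L arc)) ⟩
      (if does (suc p <? p₀) then suc p else p)
        ≡⟨ cong (λ b → if b then suc p else p) (dec-false (suc p <? p₀) (≤⇒≯ (m≤n⇒m≤1+n (≮⇒≥ p≮p₀)))) ⟩
      p                                           ∎
      where
      open ≡-Reasoning
      arc = arc-from p (≮⇒≥ p≮p₀) p<L′

    closes′ : f′ L′ ≈ f′ 0
    closes′ = begin
      f′ L′ % q        ≡⟨ cong (_% q) (f′-from L′ p₀≤L′) ⟩
      f (suc L′) % q   ≡⟨ cong (λ l → f l % q) L≡1+L′ ⟨
      f L % q          ≡⟨ closes ⟩
      f 0 % q          ≡⟨ f′≈f 0 z≤n ⟨
      f′ 0 % q         ∎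
      where open ≡-Reasoning

    removed : ClosedWalk G
    removed = record { L = L′ ; f = f′ ; closes = closes′ ; arc∈G = arc∈G′ ; D = D′ ; D-arc = D′-arc }

    weight-removed : weight removed + f p₀ ≡ weight W
    weight-removed = begin
      sum< f′ L′ + f p₀                                               ≡⟨ cong (λ l → sum< f′ l + f p₀) L′≡ ⟩
      sum< f′ (p₀ + m) + f p₀                                         ≡⟨ cong (_+ f p₀) (sum<-+ f′ p₀ m) ⟩
      sum< f′ p₀ + sum< (λ k → f′ (p₀ + k)) m + f p₀
        ≡⟨ cong₂ (λ x y → x + y + f p₀) (sum<-cong p₀ f′-before) (sum<-cong m (λ k _ → f′-from (p₀ + k) (m≤m+n p₀ k))) ⟩
      sum< f p₀ + sum< (λ k → f (suc (p₀ + k))) m + f p₀              ≡⟨ swap (sum< f p₀) _ (f p₀) ⟩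
      sum< f p₀ + (f p₀ + sum< (λ k → f (suc (p₀ + k))) m)
        ≡⟨ cong (sum< f p₀ +_) (cong₂ _+_ (cong f (+-identityʳ p₀)) (sum<-cong m (λ k _ → cong f (+-suc p₀ k)))) ⟨
      sum< f p₀ + (f (p₀ + 0) + sum< (λ k → f (p₀ + suc k)) m)        ≡⟨ cong (sum< f p₀ +_) (sum<-suc (λ k → f (p₀ + k)) m) ⟨
      sum< f p₀ + sum< (λ k → f (p₀ + k)) (suc m)                     ≡⟨ sum<-+ f p₀ (suc m) ⟨
      sum< f (p₀ + suc m)                                             ≡⟨ cong (sum< f) L≡ ⟨
      sum< f L                                                        ∎
      where
      open ≡-Reasoning
      m = L′ ∸ p₀
      L′≡ : L′ ≡ p₀ + m
      L′≡ = sym (m+[n∸m]≡n p₀≤L′)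
      L≡ : L ≡ p₀ + suc m
      L≡ = trans L≡1+L′ (trans (cong suc L′≡) (sym (+-suc p₀ m)))
      swap : ∀ a b c → a + b + c ≡ a + (c + b)
      swap = solve-∀

-- The closed walk 0, α, 1, α − 1, …, α, 0 uses the arcs with sum α leaving 0, …, α and those with sum α + 1
-- leaving α, …, 1.
module Zigzag (q : ℕ) .{{_ : NonZero q}} (α : ℕ) where
  open Walks q

  zig : ℕ → ℕ → ℕ
  zig j zero = j
  zig j (suc _) = α ∸ j

  f : ℕ → ℕ
  f p = zig (p / 2) (p % 2)

  L : ℕ
  L = 1 + α * 2

  f-even : ∀ j → f (0 + j * 2) ≡ j
  f-even j rewrite [r+k*d]/d≡k {2} 0 j z<s | [r+k*d]%d≡r {2} 0 j z<s = refl

  f-odd : ∀ j → f (1 + j * 2) ≡ α ∸ j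
  f-odd j rewrite [r+k*d]/d≡k {2} 1 j (s<s z<s) | [r+k*d]%d≡r {2} 1 j (s<s z<s) = refl

  data Position : ℕ → Set where
    even : ∀ j → j ≤ α → Position (0 + j * 2)
    odd  : ∀ j → j < α → Position (1 + j * 2)

  position : ∀ p → p < L → Position p
  position p p<L = subst Position (sym p≡) (go (p % 2) (m%n<n p 2) (subst (_< L) p≡ p<L))
    where
    p≡ = m≡m%n+[m/n]*n p 2
    go : ∀ r → r < 2 → r + p / 2 * 2 < L → Position (r + p / 2 * 2)
    go zero _ lt = even (p / 2) (*-cancelʳ-≤ (p / 2) α 2 (≤-pred lt))
    go (suc zero) _ lt = odd (p / 2) (*-cancelʳ-< 2 (p / 2) α (≤-pred lt))
    go (suc (suc _)) (s≤s (s≤s ())) _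

  -- P p = sum< f p
  P : ℕ → ℕ
  P p = (p / 2) * α + (p % 2) * (p / 2)

  P-even : ∀ j → P (0 + j * 2) ≡ j * α
  P-even j rewrite [r+k*d]/d≡k {2} 0 j z<s | [r+k*d]%d≡r {2} 0 j z<s = +-identityʳ (j * α)

  P-odd : ∀ j → P (1 + j * 2) ≡ j * α + j
  P-odd j rewrite [r+k*d]/d≡k {2} 1 j (s<s z<s) | [r+k*d]%d≡r {2} 1 j (s<s z<s) = cong (j * α +_) (+-identityʳ j)

  module _ (1+α<q : suc α < q) where

    ≤α⇒%q : ∀ {x} → x ≤ α → x % q ≡ x
    ≤α⇒%q x≤α = m<n⇒m%n≡m (<-trans (s≤s x≤α) 1+α<q)

    α∸j%q : ∀ j → (α ∸ j) % q ≡ α ∸ j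
    α∸j%q j = ≤α⇒%q (m∸n≤m α j)

    D : ℕ → ℕ → ℕ
    D a b = if does ((a + b) % q ≟ α) then a * 2 else b * 2 ∸ 1

    arc-sum : ∀ p → p < L → ((f p % q + f (suc p) % q) % q ≡ α) ⊎ ((f p % q + f (suc p) % q) % q ≡ suc α)
    arc-sum p p<L = go (position p p<L)
      where
      go : ∀ {p} → Position p → ((f p % q + f (suc p) % q) % q ≡ α) ⊎ ((f p % q + f (suc p) % q) % q ≡ suc α)
      go (even j j≤α) rewrite f-even j | f-odd j | ≤α⇒%q j≤α | α∸j%q j | m+[n∸m]≡n j≤α = inj₁ (≤α⇒%q ≤-refl)
      go (odd j j<α) rewrite f-odd j | f-even (suc j) | α∸j%q j | ≤α⇒%q j<α | +-suc (α ∸ j) j | m∸n+n≡m (<⇒≤ j<α) =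
        inj₂ (m<n⇒m%n≡m 1+α<q)

    D-arc : ∀ p → p < L → D (f p % q) (f (suc p) % q) ≡ p
    D-arc p p<L = go (position p p<L)
      where
      go : ∀ {p} → Position p → D (f p % q) (f (suc p) % q) ≡ p
      go (even j j≤α) rewrite f-even j | f-odd j | ≤α⇒%q j≤α | α∸j%q j | m+[n∸m]≡n j≤α | ≤α⇒%q (≤-refl {α}) =
        cong (λ b → if b then j * 2 else (α ∸ j) * 2 ∸ 1) (dec-true (α ≟ α) refl)
      go (odd j j<α) rewrite f-odd j | f-even (suc j) | α∸j%q j | ≤α⇒%q j<α | +-suc (α ∸ j) j | m∸n+n≡m (<⇒≤ j<α)
                           | m<n⇒m%n≡m 1+α<q =
        cong (λ b → if b then (α ∸ j) * 2 else suc j * 2 ∸ 1) (dec-false (suc α ≟ α) 1+n≢n)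

    closes : f L ≈ f 0
    closes = cong (_% q) (trans (f-odd α) (trans (n∸n≡0 α) (sym (f-even 0))))

    module _ {G : ℕ → ℕ → Set}
      (arc-even : ∀ j → j ≤ α → G j (α ∸ j)) (arc-odd : ∀ j → j < α → G (α ∸ j) (suc j)) where

      arc∈G : ∀ p → p < L → G (f p % q) (f (suc p) % q)
      arc∈G p p<L = go (position p p<L)
        where
        go : ∀ {p} → Position p → G (f p % q) (f (suc p) % q)
        go (even j j≤α) rewrite f-even j | f-odd j | ≤α⇒%q j≤α | α∸j%q j = arc-even j j≤α
        go (odd j j<α) rewrite f-odd j | f-even (suc j) | α∸j%q j | ≤α⇒%q j<α = arc-odd j j<α

      zigzag : ClosedWalk G
      zigzag = record { L = L ; f = f ; closes = closes ; arc∈G = arc∈G ; D = D ; D-arc = D-arc }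

      weight-zigzag : weight zigzag ≈ α * α + α
      weight-zigzag = trans (sum<-telescope f P L (cong (_% q) (P-even 0)) (λ p p<L → cong (_% q) (step (position p p<L))))
                            (cong (_% q) (P-odd α))
        where
        step : ∀ {p} → Position p → P (suc p) ≡ P p + f p
        step (even j j≤α) rewrite P-odd j | P-even j | f-even j = refl
        step (odd j j<α) rewrite P-even (suc j) | P-odd j | f-odd j = begin
          α + j * α               ≡⟨ +-comm α (j * α) ⟩
          j * α + α               ≡⟨ cong (j * α +_) (m+[n∸m]≡n (<⇒≤ j<α)) ⟨
          j * α + (j + (α ∸ j))   ≡⟨ +-assoc (j * α) j _ ⟨
          j * α + j + (α ∸ j)     ∎
          where open ≡-Reasoning

-- Block i visits v, σ i − v, v + 1, σ i − v − 1, …, v + q ≡ v and so uses every arc with sum σ i or σ i + 1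
-- exactly once.  In block 0 a detour v + j → τ − v − j → v + j is inserted at each of the first K vertices.
module Blocks (q : ℕ) .{{_ : NonZero q}} (v τ K N : ℕ) where
  open Walks q

  instance
    q*2≢0 : NonZero (q * 2)
    q*2≢0 = m*n≢0 q 2

  σ : ℕ → ℕ
  σ i = 1 + i * 2

  detour : ℕ → ℕ → ℕ
  detour j zero = v + j
  detour j (suc zero) = τ ⊖ (v + j)
  detour j (suc (suc zero)) = v + j
  detour j (suc (suc (suc _))) = 1 ⊖ (v + j)

  block : ℕ → ℕ → ℕ → ℕ
  block i j zero = v + j
  block i j (suc _) = σ i ⊖ (v + j)

  -- Partial sums of the walk, up to multiples of q.
  detourP : ℕ → ℕ → ℕ
  detourP j zero = j * (τ + 1)
  detourP j (suc zero) = j * (τ + 1) + (v + j)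
  detourP j (suc (suc zero)) = j * (τ + 1) + τ
  detourP j (suc (suc (suc _))) = j * (τ + 1) + τ + (v + j)

  blockP : ℕ → ℕ → ℕ → ℕ
  blockP i j zero = K * τ + j * σ i
  blockP i j (suc _) = K * τ + j * σ i + (v + j)

  -- Position ph + j * 4 with j < K is step ph of the detoured piece j; every later position is
  -- K * 2 + (ε + j * 2 + i * (q * 2)), vertex (i, j, ε) of the blocks.
  dispatch : (ℕ → ℕ → ℕ) → (ℕ → ℕ → ℕ → ℕ) → ℕ → ℕ
  dispatch E B p = if does (p <? K * 4) then E (p / 4) (p % 4)
                   else B ((p ∸ K * 2) / (q * 2)) ((p ∸ K * 2) % (q * 2) / 2) ((p ∸ K * 2) % (q * 2) % 2)

  f : ℕ → ℕ
  f = dispatch detour block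

  P : ℕ → ℕ
  P = dispatch detourP blockP

  L : ℕ
  L = K * 2 + N * (q * 2)

  block-pos : ℕ → ℕ → ℕ → ℕ
  block-pos i j ε = K * 2 + (ε + j * 2 + i * (q * 2))

  next-block-pos : ∀ i j → suc (block-pos i j 1) ≡ block-pos i (suc j) 0
  next-block-pos i j = sym (+-suc (K * 2) (1 + j * 2 + i * (q * 2)))

  NoDetour : ℕ → ℕ → Set
  NoDetour i j = 0 < i ⊎ K ≤ j

  dispatch-detour : ∀ E B j ph → j < K → ph < 4 → dispatch E B (ph + j * 4) ≡ E j ph
  dispatch-detour E B j ph j<K ph<4
    rewrite dec-true (ph + j * 4 <? K * 4) (<-≤-trans (+-monoˡ-< (j * 4) ph<4) (*-monoˡ-≤ 4 j<K)) =
    cong₂ E ([r+k*d]/d≡k ph j ph<4) ([r+k*d]%d≡r ph j ph<4)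

  K*2≤offset : ∀ i j ε → K ≤ q → NoDetour i j → K * 2 ≤ ε + j * 2 + i * (q * 2)
  K*2≤offset (suc i) j ε K≤q (inj₁ _) =
    ≤-trans (*-monoˡ-≤ 2 K≤q) (≤-trans (m≤m+n (q * 2) (i * (q * 2))) (m≤n+m _ (ε + j * 2)))
  K*2≤offset i j ε K≤q (inj₂ K≤j) = ≤-trans (*-monoˡ-≤ 2 K≤j) (≤-trans (m≤n+m (j * 2) ε) (m≤m+n (ε + j * 2) _))

  dispatch-block : ∀ E B i j ε → ε < 2 → j < q → K ≤ q → NoDetour i j → dispatch E B (block-pos i j ε) ≡ B i j ε
  dispatch-block E B i j ε ε<2 j<q K≤q nd
    rewrite dec-false (block-pos i j ε <? K * 4)
              (≤⇒≯ (subst (_≤ block-pos i j ε) (sym (*-distribˡ-+ K 2 2)) (+-monoʳ-≤ (K * 2) (K*2≤offset i j ε K≤q nd)))) =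
    trans (cong₂ (λ a b → B a b ((block-pos i j ε ∸ K * 2) % (q * 2) % 2)) e₁ e₂) (cong (B i j) e₃)
    where
    r = ε + j * 2
    r<q*2 : r < q * 2
    r<q*2 = <-≤-trans (+-monoˡ-< (j * 2) ε<2) (*-monoˡ-≤ 2 j<q)
    offset : block-pos i j ε ∸ K * 2 ≡ r + i * (q * 2)
    offset = m+n∸m≡n (K * 2) _
    e₁ : (block-pos i j ε ∸ K * 2) / (q * 2) ≡ i
    e₁ = trans (cong (_/ (q * 2)) offset) ([r+k*d]/d≡k r i r<q*2)
    e₀ : (block-pos i j ε ∸ K * 2) % (q * 2) ≡ r
    e₀ = trans (cong (_% (q * 2)) offset) ([r+k*d]%d≡r r i r<q*2)
    e₂ : (block-pos i j ε ∸ K * 2) % (q * 2) / 2 ≡ j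
    e₂ = trans (cong (_/ 2) e₀) ([r+k*d]/d≡k ε j ε<2)
    e₃ : (block-pos i j ε ∸ K * 2) % (q * 2) % 2 ≡ ε
    e₃ = trans (cong (_% 2) e₀) ([r+k*d]%d≡r ε j ε<2)

  data Position : ℕ → Set where
    in-detour : ∀ j ph → j < K → ph < 4 → Position (ph + j * 4)
    in-block  : ∀ i j ε → i < N → j < q → ε < 2 → NoDetour i j → Position (block-pos i j ε)

  block-position : ∀ X → K * 2 ≤ X → X < N * (q * 2) → Position (K * 2 + X)
  block-position X K*2≤X X<N*q*2 = subst (λ x → Position (K * 2 + x)) (sym X≡) (in-block i j ε i<N j<q ε<2 no-detour)
    where
    r = X % (q * 2)
    i = X / (q * 2)
    j = r / 2
    ε = r % 2
    i<N : i < N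
    i<N = m<n*o⇒m/o<n X<N*q*2
    j<q : j < q
    j<q = m<n*o⇒m/o<n (m%n<n X (q * 2))
    ε<2 : ε < 2
    ε<2 = m%n<n r 2
    X≡ : X ≡ ε + j * 2 + i * (q * 2)
    X≡ = trans (m≡m%n+[m/n]*n X (q * 2)) (cong (_+ i * (q * 2)) (m≡m%n+[m/n]*n r 2))
    no-detour : NoDetour i j
    no-detour with 0 <? i
    ... | yes 0<i = inj₁ 0<i
    ... | no 0≮i = inj₂ (≮⇒≥ λ j<K →
      <⇒≱ (<-≤-trans (+-monoˡ-< (j * 2) ε<2) (*-monoˡ-≤ 2 j<K)) (subst (K * 2 ≤_) X≡′ K*2≤X))
      where
      X≡′ : X ≡ ε + j * 2
      X≡′ = trans X≡ (trans (cong (λ z → ε + j * 2 + z * (q * 2)) (n≤0⇒n≡0 (≮⇒≥ 0≮i))) (+-identityʳ _))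

  position : ∀ p → p < L → Position p
  position p p<L with p <? K * 4
  ... | yes p<K*4 = subst Position (sym (m≡m%n+[m/n]*n p 4)) (in-detour (p / 4) (p % 4) (m<n*o⇒m/o<n p<K*4) (m%n<n p 4))
  ... | no p≮K*4 = subst Position (m+[n∸m]≡n (≤-trans K*2≤K*4 K*4≤p))
         (block-position (p ∸ K * 2) K*2≤X (+-cancelˡ-< (K * 2) _ _ (subst (_< L) (sym (m+[n∸m]≡n (≤-trans K*2≤K*4 K*4≤p))) p<L)))
    where
    K*4≤p = ≮⇒≥ p≮K*4
    K*2≤K*4 : K * 2 ≤ K * 4
    K*2≤K*4 = *-monoʳ-≤ K (s≤s (s≤s z≤n))
    K*2≤X : K * 2 ≤ p ∸ K * 2
    K*2≤X = m+n≤o⇒m≤o∸n (K * 2) (subst (_≤ p) (*-distribˡ-+ K 2 2) K*4≤p)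

  -- The position of the arc leaving vertex (i, j, ε) of the blocks, shifted into the detour region for i = 0, j < K.
  arc-pos : ℕ → ℕ → ℕ → ℕ
  arc-pos i j ε = if does (i ≟ 0) ∧ does (j <? K) then (2 + ε) + j * 4 else block-pos i j ε

  -- Arcs with sum τ are detour arcs, told apart by their tails; the others have sum σ i or σ i + 1.
  D : ℕ → ℕ → ℕ
  D a b = if does ((a + b) % q ≟ τ % q)
    then (if does ((a ⊖ v) <? K) then 0 + (a ⊖ v) * 4 else 1 + (b ⊖ v) * 4)
    else (if does ((a + b) % q % 2 ≟ 1) then arc-pos ((a + b) % q / 2) (a ⊖ v) 0
          else arc-pos ((a + b) % q / 2 ∸ 1) (b ⊖ (v + 1)) 1)

  module Properties (K<q : K < q) (end-plain : NoDetour N 0) (N*2<q : N * 2 < q)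
    (τ≢block-sum : ∀ s → 0 < s → s ≤ N * 2 → s ≢ τ % q)
    (detour-far : ∀ j → j < K → K ≤ (τ ⊖ (v + j)) ⊖ v)
    (G : ℕ → ℕ → Set)
    (out∈G : ∀ j → j < K → G ((v + j) % q) ((τ ⊖ (v + j)) % q))
    (back∈G : ∀ j → j < K → G ((τ ⊖ (v + j)) % q) ((v + j) % q))
    (odd∈G : ∀ i j → i < N → j < q → G ((v + j) % q) ((σ i ⊖ (v + j)) % q))
    (even∈G : ∀ i j → i < N → j < q → G ((σ i ⊖ (v + j)) % q) ((v + suc j) % q)) where

    K≤q : K ≤ q
    K≤q = <⇒≤ K<q

    j<K⇒0<N : ∀ {j} → j < K → 0 < N
    j<K⇒0<N j<K = [ id , (λ K≤0 → ⊥-elim (<⇒≱ j<K (≤-trans K≤0 z≤n))) ]′ end-plain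

    j<K⇒j<q : ∀ {j} → j < K → j < q
    j<K⇒j<q j<K = <-trans j<K K<q

    σ+1≤N*2 : ∀ i → i < N → suc (σ i) ≤ N * 2
    σ+1≤N*2 i i<N = *-monoˡ-≤ 2 i<N

    σ+1<q : ∀ i → i < N → suc (σ i) < q
    σ+1<q i i<N = ≤-<-trans (σ+1≤N*2 i i<N) N*2<q

    dispatch-after-detour : ∀ E B j → j < K →
      (suc j < K × dispatch E B (suc (3 + j * 4)) ≡ E (suc j) 0) ⊎ (suc j ≡ K × dispatch E B (suc (3 + j * 4)) ≡ B 0 K 0)
    dispatch-after-detour E B j j<K with suc j <? K
    ... | yes 1+j<K = inj₁ (1+j<K , dispatch-detour E B (suc j) 0 1+j<K z<s)
    ... | no 1+j≮K = inj₂ (1+j≡K , trans (cong (dispatch E B) next≡) (dispatch-block E B 0 K 0 z<s K<q K≤q (inj₂ ≤-refl)))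
      where
      1+j≡K = ≤-antisym j<K (≮⇒≥ 1+j≮K)
      next≡ : suc (3 + j * 4) ≡ block-pos 0 K 0
      next≡ = trans (cong (_* 4) 1+j≡K) (trans (*-distribˡ-+ K 2 2) (cong (K * 2 +_) (sym (+-identityʳ (K * 2)))))

    dispatch-after-block-0 : ∀ E B i j → j < q → NoDetour i j → dispatch E B (suc (block-pos i j 0)) ≡ B i j 1
    dispatch-after-block-0 E B i j j<q nd =
      trans (cong (dispatch E B) (sym (+-suc (K * 2) _))) (dispatch-block E B i j 1 (s<s z<s) j<q K≤q nd)

    dispatch-after-block-1 : ∀ E B i j → j < q → NoDetour i j →
      (suc j < q × dispatch E B (suc (block-pos i j 1)) ≡ B i (suc j) 0) ⊎
      (suc j ≡ q × dispatch E B (suc (block-pos i j 1)) ≡ B (suc i) 0 0)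
    dispatch-after-block-1 E B i j j<q nd with suc j <? q
    ... | yes 1+j<q = inj₁ (1+j<q , trans (cong (dispatch E B) (next-block-pos i j)) (dispatch-block E B i (suc j) 0 z<s 1+j<q K≤q (nd′ nd)))
      where
      nd′ : NoDetour i j → NoDetour i (suc j)
      nd′ (inj₁ 0<i) = inj₁ 0<i
      nd′ (inj₂ K≤j) = inj₂ (m≤n⇒m≤1+n K≤j)
    ... | no 1+j≮q = inj₂ (1+j≡q , trans (cong (dispatch E B) (trans (next-block-pos i j) (cong (λ x → block-pos i x 0) 1+j≡q)))
                                         (dispatch-block E B (suc i) 0 0 z<s 0<q K≤q (inj₁ z<s)))
      where 1+j≡q = ≤-antisym j<q (≮⇒≥ 1+j≮q)

    dispatch-start : ∀ E B {x} → E 0 0 ≡ x → (K ≡ 0 → B 0 0 0 ≡ x) → dispatch E B 0 ≡ x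
    dispatch-start E B E00≡x B00≡x with 0 <? K
    ... | yes 0<K = trans (dispatch-detour E B 0 0 0<K z<s) E00≡x
    ... | no 0≮K = trans (cong (dispatch E B) 0≡)
      (trans (dispatch-block E B 0 0 0 z<s 0<q K≤q (inj₂ (≤-reflexive K≡0))) (B00≡x K≡0))
      where
      K≡0 = n≤0⇒n≡0 (≮⇒≥ 0≮K)
      0≡ : 0 ≡ block-pos 0 0 0
      0≡ = sym (trans (+-identityʳ (K * 2)) (cong (_* 2) K≡0))

    f-detour : ∀ j ph → j < K → ph < 4 → f (ph + j * 4) ≡ detour j ph
    f-detour = dispatch-detour detour block

    f-block : ∀ i j ε → ε < 2 → j < q → NoDetour i j → f (block-pos i j ε) ≡ block i j ε
    f-block i j ε ε<2 j<q = dispatch-block detour block i j ε ε<2 j<q K≤q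

    f-after-block : ∀ i j → j < q → NoDetour i j → f (suc (block-pos i j 1)) ≈ v + suc j
    f-after-block i j j<q nd with dispatch-after-block-1 detour block i j j<q nd
    ... | inj₁ (_ , e) = cong (_% q) e
    ... | inj₂ (1+j≡q , e) =
      trans (cong (_% q) (trans e (+-identityʳ v))) (trans (sym (m+q≈m v)) (cong (λ x → (v + x) % q) (sym 1+j≡q)))

    f-0 : f 0 ≡ v + 0
    f-0 = dispatch-start detour block refl (λ _ → refl)

    data Arc : ℕ → ℕ → Set where
      detour-out  : ∀ j → j < K → Arc (v + j) (τ ⊖ (v + j))
      detour-back : ∀ j → j < K → Arc (τ ⊖ (v + j)) (v + j)
      block-odd   : ∀ i j → i < N → j < q → Arc (v + j) (σ i ⊖ (v + j))
      block-even  : ∀ i j → i < N → j < q → Arc (σ i ⊖ (v + j)) (v + suc j)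

    arc-position : ∀ {x y} → Arc x y → ℕ
    arc-position (detour-out j _) = 0 + j * 4
    arc-position (detour-back j _) = 1 + j * 4
    arc-position (block-odd i j _ _) = arc-pos i j 0
    arc-position (block-even i j _ _) = arc-pos i j 1

    arc-pos-detour : ∀ j ε → j < K → arc-pos 0 j ε ≡ (2 + ε) + j * 4
    arc-pos-detour j ε j<K rewrite dec-true (j <? K) j<K = refl

    arc-pos-block : ∀ i j ε → NoDetour i j → arc-pos i j ε ≡ block-pos i j ε
    arc-pos-block (suc i) j ε _ = refl
    arc-pos-block zero j ε (inj₂ K≤j) rewrite dec-false (j <? K) (≤⇒≯ K≤j) = refl

    record ArcAt (p : ℕ) : Set where
      field
        {x y} : ℕ
        head : f p ≈ x
        tail : f (suc p) ≈ y
        arc : Arc x y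
        at : arc-position arc ≡ p

    arc-at : ∀ p → p < L → ArcAt p
    arc-at p p<L = go (position p p<L)
      where
      mk : ∀ {p x y} → f p ≡ x → f (suc p) ≈ y → (a : Arc x y) → arc-position a ≡ p → ArcAt p
      mk e₁ e₂ a e₃ = record { head = cong (_% q) e₁ ; tail = e₂ ; arc = a ; at = e₃ }
      go : ∀ {p} → Position p → ArcAt p
      go (in-detour j 0 j<K _) =
        mk (f-detour j 0 j<K z<s) (cong (_% q) (f-detour j 1 j<K (s<s z<s))) (detour-out j j<K) refl
      go (in-detour j 1 j<K _) =
        mk (f-detour j 1 j<K (s<s z<s)) (cong (_% q) (f-detour j 2 j<K (s<s (s<s z<s)))) (detour-back j j<K) refl
      go (in-detour j 2 j<K _) =
        mk (f-detour j 2 j<K (s<s (s<s z<s))) (cong (_% q) (f-detour j 3 j<K ≤-refl))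
           (block-odd 0 j (j<K⇒0<N j<K) (j<K⇒j<q j<K)) (arc-pos-detour j 0 j<K)
      go (in-detour j 3 j<K _) with dispatch-after-detour detour block j j<K
      ... | inj₁ (_ , e) = mk (f-detour j 3 j<K ≤-refl) (cong (_% q) e)
                              (block-even 0 j (j<K⇒0<N j<K) (j<K⇒j<q j<K)) (arc-pos-detour j 1 j<K)
      ... | inj₂ (1+j≡K , e) = mk (f-detour j 3 j<K ≤-refl) (cong (_% q) (trans e (cong (v +_) (sym 1+j≡K))))
                                  (block-even 0 j (j<K⇒0<N j<K) (j<K⇒j<q j<K)) (arc-pos-detour j 1 j<K)
      go (in-block i j 0 i<N j<q _ nd) =
        mk (f-block i j 0 z<s j<q nd) (cong (_% q) (dispatch-after-block-0 detour block i j j<q nd))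
           (block-odd i j i<N j<q) (arc-pos-block i j 0 nd)
      go (in-block i j 1 i<N j<q _ nd) =
        mk (f-block i j 1 (s<s z<s) j<q nd) (f-after-block i j j<q nd) (block-even i j i<N j<q) (arc-pos-block i j 1 nd)
      go (in-detour j (suc (suc (suc (suc _)))) _ (s≤s (s≤s (s≤s (s≤s ())))))
      go (in-block i j (suc (suc _)) _ _ (s≤s (s≤s ())) _)

    v+j⊖v : ∀ j → j < q → (v + j) % q ⊖ v ≡ j
    v+j⊖v j j<q = ⊖-unique j<q (m%q≈m (v + j))

    v+1+j⊖v+1 : ∀ j → j < q → (v + suc j) % q ⊖ (v + 1) ≡ j
    v+1+j⊖v+1 j j<q = ⊖-unique j<q (trans (m%q≈m (v + suc j)) (cong (_% q) (sym (+-assoc v 1 j))))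

    block-even-sum : ∀ i j → i < N → ((σ i ⊖ (v + j)) % q + (v + suc j) % q) % q ≡ suc (σ i)
    block-even-sum i j i<N = begin
      ((σ i ⊖ (v + j)) % q + (v + suc j) % q) % q    ≡⟨ cong (λ z → ((σ i ⊖ (v + j)) % q + z % q) % q) (+-suc v j) ⟩
      ((σ i ⊖ (v + j)) % q + suc (v + j) % q) % q    ≡⟨ ⊖-sum-suc (v + j) (σ i) ⟩
      suc (σ i) % q                                  ≡⟨ m<n⇒m%n≡m (σ+1<q i i<N) ⟩
      suc (σ i)                                      ∎
      where open ≡-Reasoning

    block-odd-sum : ∀ i j → i < N → ((v + j) % q + (σ i ⊖ (v + j)) % q) % q ≡ σ i
    block-odd-sum i j i<N = trans (⊖-sumˡ (v + j) (σ i)) (m<n⇒m%n≡m (<-trans (n<1+n (σ i)) (σ+1<q i i<N)))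

    D-Arc : ∀ {x y} (a : Arc x y) → D (x % q) (y % q) ≡ arc-position a
    D-Arc (detour-out j j<K)
      rewrite ⊖-sumˡ (v + j) τ | dec-true (τ % q ≟ τ % q) refl | v+j⊖v j (j<K⇒j<q j<K) | dec-true (j <? K) j<K = refl
    D-Arc (detour-back j j<K)
      rewrite ⊖-sumʳ (v + j) τ | dec-true (τ % q ≟ τ % q) refl | [m⊖n]%q≡m⊖n τ (v + j)
            | dec-false ((τ ⊖ (v + j)) ⊖ v <? K) (≤⇒≯ (detour-far j j<K)) | v+j⊖v j (j<K⇒j<q j<K) = refl
    D-Arc (block-odd i j i<N j<q)
      rewrite block-odd-sum i j i<N | dec-false (σ i ≟ τ % q) (τ≢block-sum (σ i) z<s (<⇒≤ (σ+1≤N*2 i i<N)))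
            | [r+k*d]%d≡r {2} 1 i (s<s z<s) | [r+k*d]/d≡k {2} 1 i (s<s z<s) | v+j⊖v j j<q = refl
    D-Arc (block-even i j i<N j<q)
      rewrite block-even-sum i j i<N | dec-false (suc (σ i) ≟ τ % q) (τ≢block-sum (suc (σ i)) z<s (σ+1≤N*2 i i<N))
            | [r+k*d]%d≡r {2} 0 (suc i) z<s | [r+k*d]/d≡k {2} 0 (suc i) z<s | v+1+j⊖v+1 j j<q = refl

    Arc∈G : ∀ {x y} → Arc x y → G (x % q) (y % q)
    Arc∈G (detour-out j j<K) = out∈G j j<K
    Arc∈G (detour-back j j<K) = back∈G j j<K
    Arc∈G (block-odd i j i<N j<q) = odd∈G i j i<N j<q
    Arc∈G (block-even i j i<N j<q) = even∈G i j i<N j<q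

    arc∈G : ∀ p → p < L → G (f p % q) (f (suc p) % q)
    arc∈G p p<L = subst₂ G (sym head) (sym tail) (Arc∈G arc)
      where open ArcAt (arc-at p p<L)

    D-arc : ∀ p → p < L → D (f p % q) (f (suc p) % q) ≡ p
    D-arc p p<L = trans (cong₂ D head tail) (trans (D-Arc arc) at)
      where open ArcAt (arc-at p p<L)

    closes : f L ≈ f 0
    closes = cong (_% q) (trans (f-block N 0 0 z<s 0<q end-plain) (sym f-0))

    blocks : ClosedWalk G
    blocks = record { L = L ; f = f ; closes = closes ; arc∈G = arc∈G ; D = D ; D-arc = D-arc }

    arc-sum : ∀ p → p < L →
      (0 < (f p % q + f (suc p) % q) % q × (f p % q + f (suc p) % q) % q ≤ N * 2) ⊎ ((f p % q + f (suc p) % q) % q ≡ τ % q)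
    arc-sum p p<L = subst (λ z → (0 < z × z ≤ N * 2) ⊎ (z ≡ τ % q)) (sym (cong₂ (λ u w → (u + w) % q) head tail)) (go arc)
      where
      open ArcAt (arc-at p p<L)
      go : ∀ {x y} → Arc x y → (0 < (x % q + y % q) % q × (x % q + y % q) % q ≤ N * 2) ⊎ ((x % q + y % q) % q ≡ τ % q)
      go (detour-out j _) = inj₂ (⊖-sumˡ (v + j) τ)
      go (detour-back j _) = inj₂ (⊖-sumʳ (v + j) τ)
      go (block-odd i j i<N _) = inj₁ (subst (λ z → 0 < z × z ≤ N * 2) (sym (block-odd-sum i j i<N)) (z<s , <⇒≤ (σ+1≤N*2 i i<N)))
      go (block-even i j i<N _) = inj₁ (subst (λ z → 0 < z × z ≤ N * 2) (sym (block-even-sum i j i<N)) (z<s , σ+1≤N*2 i i<N))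

    P-detour : ∀ j ph → j < K → ph < 4 → P (ph + j * 4) ≡ detourP j ph
    P-detour = dispatch-detour detourP blockP

    P-block : ∀ i j ε → ε < 2 → j < q → NoDetour i j → P (block-pos i j ε) ≡ blockP i j ε
    P-block i j ε ε<2 j<q = dispatch-block detourP blockP i j ε ε<2 j<q K≤q

    m+n+[o⊖n]≈m+o : ∀ m n o → m + n + (o ⊖ n) ≈ m + o
    m+n+[o⊖n]≈m+o m n o = trans (cong (_% q) (+-assoc m n (o ⊖ n)))
      (+-congˡ≈ m (trans (cong (_% q) (+-comm n (o ⊖ n))) (m⊖n+n≈m o n)))

    step : ∀ {p A B C} → P (suc p) ≡ A → P p ≡ B → f p ≡ C → A ≈ B + C → P (suc p) ≈ P p + f p
    step refl refl refl e = e

    P-step-detour : ∀ j ph → j < K → ph < 4 → P (suc (ph + j * 4)) ≈ P (ph + j * 4) + f (ph + j * 4)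
    P-step-detour j 0 j<K _ = step (P-detour j 1 j<K (s<s z<s)) (P-detour j 0 j<K z<s) (f-detour j 0 j<K z<s) refl
    P-step-detour j 1 j<K _ = step (P-detour j 2 j<K (s<s (s<s z<s))) (P-detour j 1 j<K (s<s z<s)) (f-detour j 1 j<K (s<s z<s))
      (sym (m+n+[o⊖n]≈m+o (j * (τ + 1)) (v + j) τ))
    P-step-detour j 2 j<K _ = step (P-detour j 3 j<K ≤-refl) (P-detour j 2 j<K (s<s (s<s z<s))) (f-detour j 2 j<K (s<s (s<s z<s))) refl
    P-step-detour j 3 j<K _ with dispatch-after-detour detourP blockP j j<K
    ... | inj₁ (_ , e) = step e (P-detour j 3 j<K ≤-refl) (f-detour j 3 j<K ≤-refl)
      (trans (cong (_% q) (lemma j τ)) (sym (m+n+[o⊖n]≈m+o (j * (τ + 1) + τ) (v + j) 1)))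
      where
      lemma : ∀ j τ → suc j * (τ + 1) ≡ j * (τ + 1) + τ + 1
      lemma = solve-∀
    ... | inj₂ (1+j≡K , e) = step e (P-detour j 3 j<K ≤-refl) (f-detour j 3 j<K ≤-refl)
      (trans (cong (_% q) (trans (cong (λ k → k * τ + k * 1) (sym 1+j≡K)) (lemma j τ)))
             (sym (m+n+[o⊖n]≈m+o (j * (τ + 1) + τ) (v + j) 1)))
      where
      lemma : ∀ j τ → suc j * τ + suc j * 1 ≡ j * (τ + 1) + τ + 1
      lemma = solve-∀
    P-step-detour j (suc (suc (suc (suc _)))) _ (s≤s (s≤s (s≤s (s≤s ()))))

    P-step-block : ∀ i j ε → j < q → ε < 2 → NoDetour i j →
      P (suc (block-pos i j ε)) ≈ P (block-pos i j ε) + f (block-pos i j ε)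
    P-step-block i j 0 j<q _ nd =
      step (dispatch-after-block-0 detourP blockP i j j<q nd) (P-block i j 0 z<s j<q nd) (f-block i j 0 z<s j<q nd) refl
    P-step-block i j 1 j<q _ nd with dispatch-after-block-1 detourP blockP i j j<q nd
    ... | inj₁ (_ , e) = step e (P-block i j 1 (s<s z<s) j<q nd) (f-block i j 1 (s<s z<s) j<q nd)
      (trans (cong (_% q) (lemma (K * τ) j (σ i))) (sym (m+n+[o⊖n]≈m+o (K * τ + j * σ i) (v + j) (σ i))))
      where
      lemma : ∀ a j s → a + suc j * s ≡ a + j * s + s
      lemma = solve-∀
    ... | inj₂ (1+j≡q , e) = step e (P-block i j 1 (s<s z<s) j<q nd) (f-block i j 1 (s<s z<s) j<q nd)
      (trans (begin
        (K * τ + 0) % q               ≡⟨ cong (_% q) (+-identityʳ (K * τ)) ⟩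
        (K * τ) % q                   ≡⟨ m+k*q≈m (K * τ) (σ i) ⟨
        (K * τ + σ i * q) % q         ≡⟨ cong (λ z → (K * τ + σ i * z) % q) (sym 1+j≡q) ⟩
        (K * τ + σ i * suc j) % q     ≡⟨ cong (_% q) (lemma (K * τ) j (σ i)) ⟩
        (K * τ + j * σ i + σ i) % q   ∎)
       (sym (m+n+[o⊖n]≈m+o (K * τ + j * σ i) (v + j) (σ i))))
      where
      open ≡-Reasoning
      lemma : ∀ a j s → a + s * suc j ≡ a + j * s + s
      lemma = solve-∀
    P-step-block i j (suc (suc _)) _ (s≤s (s≤s ())) _

    weight-blocks : weight blocks ≈ K * τ
    weight-blocks = trans (sum<-telescope f P L P-0 P-step) (cong (_% q) P-L)
      where
      P-0 : P 0 ≈ 0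
      P-0 = cong (_% q) (dispatch-start detourP blockP refl (λ K≡0 → trans (+-identityʳ (K * τ)) (cong (_* τ) K≡0)))
      P-L : P L ≡ K * τ
      P-L = trans (P-block N 0 0 z<s 0<q end-plain) (+-identityʳ (K * τ))
      P-step : ∀ p → p < L → P (suc p) ≈ P p + f p
      P-step p p<L with position p p<L
      ... | in-detour j ph j<K ph<4 = P-step-detour j ph j<K ph<4
      ... | in-block i j ε _ j<q ε<2 nd = P-step-block i j ε j<q ε<2 nd

bound-odd : ∀ k → bound (suc (k * 2)) ≡ suc (k * 2) * (suc (k * 2) * k ∸ 1)
bound-odd k rewrite [r+k*d]%d≡r {2} 1 k (s<s z<s) =
  cong (λ x → suc (k * 2) * (x ∸ 1)) (trans (cong (_/ 2) (sym (*-assoc (suc (k * 2)) k 2))) (m*n/n≡m (suc (k * 2) * k) 2))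

bound-even : ∀ h → bound (h * 2) ≤ h * 2 * (h * (h * 2 ∸ 1) ∸ 2)
bound-even h rewrite [r+k*d]%d≡r {2} 0 h z<s =
  *-monoʳ-≤ (h * 2) (subst (λ x → x ∸ (if h * 2 ≡ᵇ 6 then 3 else 2) ≤ h * (h * 2 ∸ 1) ∸ 2) (sym half) (∸-monoʳ-≤ _ 2≤c))
  where
  swap : ∀ h x → h * 2 * x ≡ h * x * 2
  swap = solve-∀
  half : h * 2 * (h * 2 ∸ 1) / 2 ≡ h * (h * 2 ∸ 1)
  half = trans (cong (_/ 2) (swap h (h * 2 ∸ 1))) (m*n/n≡m (h * (h * 2 ∸ 1)) 2)
  2≤c : 2 ≤ (if h * 2 ≡ᵇ 6 then 3 else 2)
  2≤c with h * 2 ≡ᵇ 6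
  ... | true = s≤s (s≤s z≤n)
  ... | false = ≤-refl

even⊎odd : ∀ n → (∃[ m ] n ≡ m * 2) ⊎ (∃[ m ] n ≡ suc (m * 2))
even⊎odd zero = inj₁ (0 , refl)
even⊎odd (suc n) with even⊎odd n
... | inj₁ (m , n≡2m) = inj₂ (m , cong suc n≡2m)
... | inj₂ (m , n≡2m+1) = inj₁ (suc m , cong suc n≡2m+1)

module OneMod4 (n : ℕ) (1≤n : 1 ≤ n) where
  q : ℕ
  q = suc (n * 2 * 2)

  open Walks q

  G : ℕ → ℕ → Set
  G a b = 0 < (a + b) % q × (a + b) % q ≤ n * 2

  G-free : NegReverseFree G
  G-free a b a′ b′ _ _ _ _ (0<s , s≤2n) (_ , s′≤2n) e₁ e₂ =
    <⇒≢ (subst ((a + b) % q + (a′ + b′) % q <_) (cong suc (double (n * 2))) (s≤s (+-mono-≤ s≤2n s′≤2n)))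
        (≈0⇒≡q (m%n<n (a + b) q) (m%n<n (a′ + b′) q) 0<s (neg-reverse-sums a b a′ b′ e₁ e₂))
    where
    double : ∀ m → m + m ≡ m * 2
    double = solve-∀

  open Blocks q 1 0 0 n

  N*2<q : n * 2 < q
  N*2<q = s≤s (m≤m*n (n * 2) 2)

  σ+1≤2n : ∀ i → i < n → suc (σ i) ≤ n * 2
  σ+1≤2n i i<n = *-monoˡ-≤ 2 i<n

  odd∈G : ∀ i j → i < n → j < q → G ((1 + j) % q) ((σ i ⊖ (1 + j)) % q)
  odd∈G i j i<n _ =
    subst (λ s → 0 < s × s ≤ n * 2) (sym (trans (⊖-sumˡ (1 + j) (σ i)) (m<n⇒m%n≡m σ<q))) (z<s , <⇒≤ (σ+1≤2n i i<n))
    where σ<q = <-trans (n<1+n (σ i)) (≤-<-trans (σ+1≤2n i i<n) N*2<q)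

  even∈G : ∀ i j → i < n → j < q → G ((σ i ⊖ (1 + j)) % q) ((1 + suc j) % q)
  even∈G i j i<n _ =
    subst (λ s → 0 < s × s ≤ n * 2) (sym (trans (⊖-sum-suc (1 + j) (σ i)) (m<n⇒m%n≡m σ+1<q))) (z<s , σ+1≤2n i i<n)
    where σ+1<q = ≤-<-trans (σ+1≤2n i i<n) N*2<q

  open Properties (s≤s z≤n) (inj₁ 1≤n) N*2<q (λ s 0<s _ s≡0 → <⇒≢ 0<s (sym s≡0)) (λ _ ()) G (λ _ ()) (λ _ ()) odd∈G even∈G

  -- The arc σ 0 − q → 1 + q at the end of block 0 is the loop (1, 1).
  p₀ : ℕ
  p₀ = block-pos 0 (n * 2 * 2) 1

  p₀<L : p₀ < L
  p₀<L = ≤-trans (≤-reflexive (lemma n)) (*-monoˡ-≤ (q * 2) 1≤n)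
    where
    lemma : ∀ n → suc (0 * 2 + (1 + n * 2 * 2 * 2 + 0 * (suc (n * 2 * 2) * 2))) ≡ 1 * (suc (n * 2 * 2) * 2)
    lemma = solve-∀

  f-p₀ : f p₀ ≈ 1
  f-p₀ = trans (cong (_% q) (f-block 0 (n * 2 * 2) 1 (s<s z<s) ≤-refl (inj₂ z≤n)))
               (+-cancelʳ-≈ {1 ⊖ q} {1} q (trans (m⊖n+n≈m 1 q) (sym (m+q≈m 1))))

  loop : f p₀ ≈ f (suc p₀)
  loop = trans f-p₀ (sym (trans (f-after-block 0 (n * 2 * 2) ≤-refl (inj₂ z≤n)) (m+q≈m 1)))

  open RemoveLoop blocks p₀ p₀<L loop

  unit : weight removed * (q ∸ 1) ≈ 1
  unit = m+1≈0⇒m*[q∸1]≈1 (weight removed) (begin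
    (weight removed + 1) % q       ≡⟨ +-congˡ≈ (weight removed) f-p₀ ⟨
    (weight removed + f p₀) % q    ≡⟨ cong (_% q) weight-removed ⟩
    weight blocks % q              ≡⟨ weight-blocks ⟩
    0 % q                          ∎)
    where open ≡-Reasoning

  long : bound q ≤ q * L′
  long = ≤-reflexive (trans (bound-odd (n * 2)) (cong (λ x → q * (x ∸ 1)) (lemma n)))
    where
    lemma : ∀ n → suc (n * 2 * 2) * (n * 2) ≡ n * (suc (n * 2 * 2) * 2)
    lemma = solve-∀

  orientable : OrientableAboveBound q
  orientable = orientable-from-walk removed G-free (<-≤-trans z<s (∸-monoˡ-≤ 1 p₀<L)) (q ∸ 1) unit long

module ThreeMod4 (n : ℕ) where
  k : ℕ
  k = suc (n * 2)

  q : ℕ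
  q = suc (k * 2)

  open Walks q

  G : ℕ → ℕ → Set
  G a b = (0 < (a + b) % q × (a + b) % q < k) ⊎ ((a + b) % q ≡ k × a ≤ k) ⊎ ((a + b) % q ≡ suc k × 0 < a × a ≤ k)

  q≡k+[1+k] : q ≡ k + suc k
  q≡k+[1+k] = lemma n
    where
    lemma : ∀ n → suc (suc (n * 2) * 2) ≡ suc (n * 2) + suc (suc (n * 2))
    lemma = solve-∀

  G-sum : ∀ {a b} → G a b → 0 < (a + b) % q × (a + b) % q ≤ suc k
  G-sum (inj₁ (0<s , s<k)) = 0<s , ≤-trans (<⇒≤ s<k) (n≤1+n k)
  G-sum (inj₂ (inj₁ (s≡k , _))) = subst (λ z → 0 < z × z ≤ suc k) (sym s≡k) (z<s , n≤1+n k)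
  G-sum (inj₂ (inj₂ (s≡1+k , _))) = subst (λ z → 0 < z × z ≤ suc k) (sym s≡1+k) (z<s , ≤-refl)

  G-free : NegReverseFree G
  G-free a b a′ b′ a<q _ _ _ g g′ e₁ e₂ = go g g′
    where
    s = (a + b) % q
    s′ = (a′ + b′) % q
    s+s′≡q : s + s′ ≡ q
    s+s′≡q = ≈0⇒≡q (m%n<n (a + b) q) (m%n<n (a′ + b′) q) (proj₁ (G-sum g)) (neg-reverse-sums a b a′ b′ e₁ e₂)
    too-small : ∀ {x y} → x < k → y ≤ suc k → x + y ≢ q
    too-small {x} {y} x<k y≤1+k = <⇒≢ (subst (x + y <_) (sym q≡k+[1+k]) (+-mono-<-≤ x<k y≤1+k))
    go : G a b → G a′ b′ → ⊥
    go (inj₁ (_ , s<k)) g′ = too-small s<k (proj₂ (G-sum g′)) s+s′≡q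
    go g (inj₁ (_ , s′<k)) = too-small s′<k (proj₂ (G-sum g)) (trans (+-comm s′ s) s+s′≡q)
    go (inj₂ (inj₁ (s≡k , _))) (inj₂ (inj₁ (s′≡k , _))) =
      <⇒≢ (subst (_< q) (sym (cong₂ _+_ s≡k s′≡k)) (subst (k + k <_) (sym q≡k+[1+k]) (+-monoʳ-< k (n<1+n k)))) s+s′≡q
    go (inj₂ (inj₂ (s≡1+k , _))) (inj₂ (inj₂ (s′≡1+k , _))) =
      <⇒≢ (subst (q <_) (sym (cong₂ _+_ s≡1+k s′≡1+k))
                 (subst (_< suc k + suc k) (sym q≡k+[1+k]) (+-monoˡ-< (suc k) (n<1+n k)))) (sym s+s′≡q)
    go (inj₂ (inj₁ (s≡k , a≤k))) (inj₂ (inj₂ (_ , 0<a′ , a′≤k))) =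
      <⇒≱ (subst (k <_) (neg-reverse-shift a<q e₂ s≡k a′+k<q) (m<n+m k 0<a′)) a≤k
      where a′+k<q = subst (a′ + k <_) (sym q≡k+[1+k]) (+-mono-≤-< a′≤k (n<1+n k))
    go (inj₂ (inj₂ (s≡1+k , 0<a , a≤k))) (inj₂ (inj₁ (_ , a′≤k))) =
      <⇒≱ (s≤s a≤k) (neg-reverse-≥ a<q 0<a e₂ s≡1+k (subst (a′ + suc k ≤_) (sym q≡k+[1+k]) (+-monoˡ-≤ (suc k) a′≤k)))

  module Z = Zigzag q k
  module B = Blocks q 0 0 0 n

  k<q : k < q
  k<q = s≤s (m≤m*n k 2)

  1+k<q : suc k < q
  1+k<q = subst (suc k <_) (sym q≡k+[1+k]) (+-monoˡ-< (suc k) {0} {k} z<s)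

  zig∈G : ∀ j → j ≤ k → G j (k ∸ j)
  zig∈G j j≤k = inj₂ (inj₁ (trans (cong (_% q) (m+[n∸m]≡n j≤k)) (m<n⇒m%n≡m k<q) , j≤k))

  zag∈G : ∀ j → j < k → G (k ∸ j) (suc j)
  zag∈G j j<k = inj₂ (inj₂ (trans (cong (_% q) (trans (+-suc (k ∸ j) j) (cong suc (m∸n+n≡m (<⇒≤ j<k))))) (m<n⇒m%n≡m 1+k<q)
                           , m<n⇒0<n∸m j<k , m∸n≤m k j))

  zigzag : ClosedWalk G
  zigzag = Z.zigzag 1+k<q zig∈G zag∈G

  σ+1≤2n : ∀ i → i < n → suc (B.σ i) ≤ n * 2
  σ+1≤2n i i<n = *-monoˡ-≤ 2 i<n

  2n<k : n * 2 < k
  2n<k = ≤-refl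

  odd∈G : ∀ i j → i < n → j < q → G ((0 + j) % q) ((B.σ i ⊖ (0 + j)) % q)
  odd∈G i j i<n _ = inj₁ (subst (λ s → 0 < s × s < k) (sym (trans (⊖-sumˡ j (B.σ i)) (m<n⇒m%n≡m σ<q))) (z<s , σ<k))
    where
    σ<k = <-≤-trans (σ+1≤2n i i<n) (<⇒≤ 2n<k)
    σ<q = <-trans σ<k k<q

  even∈G : ∀ i j → i < n → j < q → G ((B.σ i ⊖ (0 + j)) % q) ((0 + suc j) % q)
  even∈G i j i<n _ = inj₁ (subst (λ s → 0 < s × s < k) (sym (trans (⊖-sum-suc j (B.σ i)) (m<n⇒m%n≡m σ+1<q))) (z<s , σ+1<k))
    where
    σ+1<k = ≤-<-trans (σ+1≤2n i i<n) 2n<k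
    σ+1<q = <-trans σ+1<k k<q

  module BP = B.Properties z<s (inj₂ z≤n) (<-trans 2n<k k<q) (λ s 0<s _ s≡0 → <⇒≢ 0<s (sym s≡0)) (λ _ ())
                           G (λ _ ()) (λ _ ()) odd∈G even∈G

  in-blocks : ℕ → ℕ → Bool
  in-blocks a b = does ((a + b) % q ≤? n * 2)

  blocks-in-blocks : ∀ p → p < B.L → in-blocks (B.f p % q) (B.f (suc p) % q) ≡ true
  blocks-in-blocks p p<L with BP.arc-sum p p<L
  ... | inj₁ (_ , s≤2n) = dec-true (_ ≤? n * 2) s≤2n
  ... | inj₂ s≡0 = dec-true (_ ≤? n * 2) (subst (_≤ n * 2) (sym s≡0) z≤n)

  zigzag-not-in-blocks : ∀ p → p < Z.L → in-blocks (Z.f p % q) (Z.f (suc p) % q) ≡ false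
  zigzag-not-in-blocks p p<L with Z.arc-sum 1+k<q p p<L
  ... | inj₁ s≡k = dec-false (_ ≤? n * 2) (λ s≤2n → <⇒≱ 2n<k (subst (_≤ n * 2) s≡k s≤2n))
  ... | inj₂ s≡1+k = dec-false (_ ≤? n * 2) (λ s≤2n → <⇒≱ (m≤n⇒m≤1+n 2n<k) (subst (_≤ n * 2) s≡1+k s≤2n))

  open Splice zigzag BP.blocks 0 in-blocks z≤n (cong (_% q) BP.f-0) blocks-in-blocks zigzag-not-in-blocks

  -- As 2 k ≡ −1, (k² + k) · 8 k = (2 k)³ + 2 (2 k)² ≡ 1.
  unit : weight spliced * (k * 8) ≈ 1
  unit = begin
    (weight spliced * (k * 8)) % q              ≡⟨ *-cong≈ {weight spliced} {k * k + k} {k * 8} {k * 8} weight≈ refl ⟩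
    ((k * k + k) * (k * 8)) % q                 ≡⟨ m+q≈m ((k * k + k) * (k * 8)) ⟨
    ((k * k + k) * (k * 8) + q) % q             ≡⟨ cong (_% q) (lemma k) ⟩
    (1 + (k * k * 4 + k * 2) * q) % q           ≡⟨ m+k*q≈m 1 (k * k * 4 + k * 2) ⟩
    1 % q                                       ∎
    where
    open ≡-Reasoning
    weight≈ : weight spliced ≈ k * k + k
    weight≈ = trans (cong (_% q) weight-spliced)
      (trans (+-cong≈ {weight zigzag} {k * k + k} {weight BP.blocks} {0 * 0} (Z.weight-zigzag 1+k<q {G} zig∈G zag∈G) BP.weight-blocks)
             (cong (_% q) (+-identityʳ (k * k + k))))
    lemma : ∀ k → (k * k + k) * (k * 8) + suc (k * 2) ≡ 1 + (k * k * 4 + k * 2) * suc (k * 2)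
    lemma = solve-∀

  long : bound q ≤ q * L′
  long = ≤-trans (≤-reflexive (bound-odd k)) (*-monoʳ-≤ q (≤-trans (m∸n≤m (q * k) 1) (≤-reflexive (lemma n))))
    where
    lemma : ∀ n → suc (suc (n * 2) * 2) * suc (n * 2) ≡ suc (suc (n * 2) * 2) + (0 * 2 + n * (suc (suc (n * 2) * 2) * 2))
    lemma = solve-∀

  orientable : OrientableAboveBound q
  orientable = orientable-from-walk spliced G-free z<s (k * 8) unit long

module TwoMod4 (K : ℕ) (1≤K : 1 ≤ K) where
  h : ℕ
  h = suc (K * 2)

  q : ℕ
  q = h * 2

  open Walks q

  G : ℕ → ℕ → Set
  G a b = (0 < (a + b) % q × (a + b) % q < h) ⊎ ((a + b) % q ≡ h × 0 < a × a < h)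

  q≡h+h : q ≡ h + h
  q≡h+h = lemma K
    where
    lemma : ∀ K → suc (K * 2) * 2 ≡ suc (K * 2) + suc (K * 2)
    lemma = solve-∀

  h<q : h < q
  h<q = subst (h <_) (sym q≡h+h) (subst (_< h + h) (+-identityʳ h) (+-monoʳ-< h {0} {h} z<s))

  G-sum : ∀ {a b} → G a b → 0 < (a + b) % q × (a + b) % q ≤ h
  G-sum (inj₁ (0<s , s<h)) = 0<s , <⇒≤ s<h
  G-sum (inj₂ (s≡h , _)) = subst (λ z → 0 < z × z ≤ h) (sym s≡h) (z<s , ≤-refl)

  G-free : NegReverseFree G
  G-free a b a′ b′ a<q _ _ _ g g′ e₁ e₂ = go g g′
    where
    s = (a + b) % q
    s′ = (a′ + b′) % q
    s+s′≡q : s + s′ ≡ q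
    s+s′≡q = ≈0⇒≡q (m%n<n (a + b) q) (m%n<n (a′ + b′) q) (proj₁ (G-sum g)) (neg-reverse-sums a b a′ b′ e₁ e₂)
    go : G a b → G a′ b′ → ⊥
    go (inj₁ (_ , s<h)) g′ = <⇒≢ (subst (s + s′ <_) (sym q≡h+h) (+-mono-<-≤ s<h (proj₂ (G-sum g′)))) s+s′≡q
    go g (inj₁ (_ , s′<h)) = <⇒≢ (subst (s + s′ <_) (sym q≡h+h) (+-mono-≤-< (proj₂ (G-sum g)) s′<h)) s+s′≡q
    go (inj₂ (s≡h , _ , a<h)) (inj₂ (_ , _ , a′<h)) =
      <⇒≱ a<h (subst (h ≤_) (neg-reverse-shift a<q e₂ s≡h (subst (a′ + h <_) (sym q≡h+h) (+-monoˡ-< h a′<h))) (m≤n+m h a′))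

  open Blocks q 1 h K K

  K*2<h : K * 2 < h
  K*2<h = ≤-refl

  K*2<q : K * 2 < q
  K*2<q = <-trans K*2<h h<q

  K<q : K < q
  K<q = ≤-<-trans (m≤m*n K 2) K*2<q

  out∈G : ∀ j → j < K → G ((1 + j) % q) ((h ⊖ (1 + j)) % q)
  out∈G j j<K = inj₂ (trans (⊖-sumˡ (1 + j) h) (m<n⇒m%n≡m h<q)
                     , subst (λ z → 0 < z × z < h) (sym (m<n⇒m%n≡m (<-trans 1+j<h h<q))) (z<s , 1+j<h))
    where
    1+j<h : 1 + j < h
    1+j<h = s≤s (≤-trans j<K (m≤m*n K 2))

  back∈G : ∀ j → j < K → G ((h ⊖ (1 + j)) % q) ((1 + j) % q)
  back∈G j j<K = inj₂ (trans (⊖-sumʳ (1 + j) h) (m<n⇒m%n≡m h<q) , subst (λ z → 0 < z × z < h)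
    (sym (trans ([m⊖n]%q≡m⊖n h (1 + j)) ([1+2K]⊖[1+j]≡2K∸j j<K K*2<q))) (m<n⇒0<n∸m (≤-trans j<K (m≤m*n K 2)) , s≤s (m∸n≤m (K * 2) j)))

  σ+1≤2K : ∀ i → i < K → suc (σ i) ≤ K * 2
  σ+1≤2K i i<K = *-monoˡ-≤ 2 i<K

  odd∈G : ∀ i j → i < K → j < q → G ((1 + j) % q) ((σ i ⊖ (1 + j)) % q)
  odd∈G i j i<K _ = inj₁ (subst (λ s → 0 < s × s < h) (sym (trans (⊖-sumˡ (1 + j) (σ i)) (m<n⇒m%n≡m σ<q))) (z<s , σ<h))
    where
    σ<h = s≤s (<⇒≤ (σ+1≤2K i i<K))
    σ<q = <-trans σ<h h<q

  even∈G : ∀ i j → i < K → j < q → G ((σ i ⊖ (1 + j)) % q) ((1 + suc j) % q)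
  even∈G i j i<K _ = inj₁ (subst (λ s → 0 < s × s < h) (sym (trans (⊖-sum-suc (1 + j) (σ i)) (m<n⇒m%n≡m σ+1<q))) (z<s , σ+1<h))
    where
    σ+1<h = s≤s (σ+1≤2K i i<K)
    σ+1<q = <-trans σ+1<h h<q

  h≢block-sum : ∀ s → 0 < s → s ≤ K * 2 → s ≢ h % q
  h≢block-sum s _ s≤2K s≡h = <⇒≢ (≤-<-trans s≤2K K*2<h) (trans s≡h (m<n⇒m%n≡m h<q))

  open Properties K<q (inj₁ 1≤K) K*2<q h≢block-sum (λ j j<K → K≤[1+2K]⊖[1+j]⊖1 j<K K*2<q) G out∈G back∈G odd∈G even∈G

  -- The arc leaving block vertex (0, j₀, 1) runs from 1 − (1 + j₀) to 2 + j₀: a loop when 2 (1 + j₀) ≡ 0, whose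
  -- deletion leaves the weight K h − (2 + j₀) ≡ −1 when K h ≡ 1 + j₀.
  module _ (j₀ : ℕ) (K≤j₀ : K ≤ j₀) (j₀<q : j₀ < q)
    (loop-at-j₀ : 2 + j₀ + (1 + j₀) ≈ 1) (K*h≈1+j₀ : K * h ≈ 1 + j₀) where
    p₀ : ℕ
    p₀ = block-pos 0 j₀ 1

    p₀<L : p₀ < L
    p₀<L = +-monoʳ-< (K * 2) (≤-trans (≤-reflexive (cong suc (+-identityʳ _)))
             (≤-trans (*-monoˡ-≤ 2 j₀<q) (≤-trans (≤-reflexive (sym (*-identityˡ (q * 2)))) (*-monoˡ-≤ (q * 2) 1≤K))))

    f-p₀ : f p₀ ≈ 2 + j₀
    f-p₀ = trans (cong (_% q) (f-block 0 j₀ 1 (s<s z<s) j₀<q (inj₂ K≤j₀)))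
                 (+-cancelʳ-≈ {1 ⊖ (1 + j₀)} {2 + j₀} (1 + j₀) (trans (m⊖n+n≈m 1 (1 + j₀)) (sym loop-at-j₀)))

    loop : f p₀ ≈ f (suc p₀)
    loop = trans f-p₀ (sym (f-after-block 0 j₀ j₀<q (inj₂ K≤j₀)))

    open RemoveLoop blocks p₀ p₀<L loop

    unit : weight removed * (q ∸ 1) ≈ 1
    unit = m+1≈0⇒m*[q∸1]≈1 (weight removed) (+-cancelʳ-≈ {weight removed + 1} {0} (1 + j₀) (begin
      (weight removed + 1 + (1 + j₀)) % q   ≡⟨ cong (_% q) (+-assoc (weight removed) 1 (1 + j₀)) ⟩
      (weight removed + (2 + j₀)) % q       ≡⟨ +-congˡ≈ (weight removed) f-p₀ ⟨
      (weight removed + f p₀) % q           ≡⟨ cong (_% q) weight-removed ⟩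
      weight blocks % q                     ≡⟨ weight-blocks ⟩
      (K * h) % q                           ≡⟨ K*h≈1+j₀ ⟩
      (1 + j₀) % q                          ∎))
      where open ≡-Reasoning

    long : bound q ≤ q * L′
    long = ≤-trans (bound-even h) (≤-reflexive (cong (λ x → q * (x ∸ 2)) (lemma K)))
      where
      lemma : ∀ K → suc (K * 2) * suc (K * 2 * 2) ≡ suc (K * 2 + K * (suc (K * 2) * 2 * 2))
      lemma = solve-∀

    orientable-at : OrientableAboveBound q
    orientable-at = orientable-from-walk removed G-free (<-≤-trans (<-≤-trans z<s (m≤n+m _ (K * 2))) p₀≤L′) (q ∸ 1) unit long

  -- j₀ = q − 1 for even K and j₀ = h − 1 for odd K.
  orientable : OrientableAboveBound q
  orientable with even⊎odd K
  ... | inj₁ (m , K≡2m) = orientable-at (suc (K * 2 * 2)) K≤j₀ ≤-refl loop-at-j₀ K*h≈1+j₀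
    where
    K≤j₀ = ≤-trans (m≤m*n K 2) (≤-trans (m≤m*n (K * 2) 2) (n≤1+n _))
    loop-at-j₀ : 2 + suc (K * 2 * 2) + (1 + suc (K * 2 * 2)) ≈ 1
    loop-at-j₀ = trans (cong (_% q) (lemma K)) (m+k*q≈m 1 2)
      where
      lemma : ∀ K → 2 + suc (K * 2 * 2) + (1 + suc (K * 2 * 2)) ≡ 1 + 2 * (suc (K * 2) * 2)
      lemma = solve-∀
    K*h≈1+j₀ : K * h ≈ q
    K*h≈1+j₀ = trans (cong (_% q) K*h≡m*q) (trans (k*q≈0 m) (sym q≈0))
      where
      lemma : ∀ m → m * 2 * suc (m * 2 * 2) ≡ m * (suc (m * 2 * 2) * 2)
      lemma = solve-∀
      K*h≡m*q : K * h ≡ m * q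
      K*h≡m*q = trans (cong (λ k → k * suc (k * 2)) K≡2m) (trans (lemma m) (cong (λ k → m * (suc (k * 2) * 2)) (sym K≡2m)))
  ... | inj₂ (m , K≡2m+1) = orientable-at (K * 2) (m≤m*n K 2) K*2<q loop-at-j₀ K*h≈1+j₀
    where
    loop-at-j₀ : 2 + K * 2 + (1 + K * 2) ≈ 1
    loop-at-j₀ = trans (cong (_% q) (lemma K)) (m+k*q≈m 1 1)
      where
      lemma : ∀ K → 2 + K * 2 + (1 + K * 2) ≡ 1 + 1 * (suc (K * 2) * 2)
      lemma = solve-∀
    K*h≈1+j₀ : K * h ≈ h
    K*h≈1+j₀ = trans (cong (_% q) K*h≡h+m*q) (m+k*q≈m h m)
      where
      lemma : ∀ m → suc (m * 2) * suc (suc (m * 2) * 2) ≡ suc (suc (m * 2) * 2) + m * (suc (suc (m * 2) * 2) * 2)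
      lemma = solve-∀
      K*h≡h+m*q : K * h ≡ h + m * q
      K*h≡h+m*q = trans (cong (λ k → k * suc (k * 2)) K≡2m+1)
        (trans (lemma m) (cong (λ k → suc (k * 2) + m * (suc (k * 2) * 2)) (sym K≡2m+1)))

module ZeroMod4 (g′ : ℕ) where
  g : ℕ
  g = suc (suc g′)

  h : ℕ
  h = g * 2

  q : ℕ
  q = h * 2

  -- α = h − 1
  α : ℕ
  α = suc (suc (suc (g′ * 2)))

  open Walks q

  G : ℕ → ℕ → Set
  G a b = (0 < (a + b) % q × (a + b) % q < α) ⊎ ((a + b) % q ≡ α × a ≤ α)
        ⊎ ((a + b) % q ≡ h × 0 < a × a < h) ⊎ ((a + b) % q ≡ suc h × 0 < a × a ≤ h)

  q≡h+h : q ≡ h + h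
  q≡h+h = lemma g′
    where
    lemma : ∀ g′ → suc (suc g′) * 2 * 2 ≡ suc (suc g′) * 2 + suc (suc g′) * 2
    lemma = solve-∀

  h<q : h < q
  h<q = subst (h <_) (sym q≡h+h) (subst (_< h + h) (+-identityʳ h) (+-monoʳ-< h {0} {h} z<s))

  1+h<q : suc h < q
  1+h<q = subst (suc h <_) (sym q≡h+h) (+-monoˡ-< h {1} {h} (s≤s (s≤s z≤n)))

  α+[1+h]≡q : α + suc h ≡ q
  α+[1+h]≡q = trans (+-suc α h) (sym q≡h+h)

  G-sum : ∀ {a b} → G a b → 0 < (a + b) % q × (a + b) % q ≤ suc h
  G-sum (inj₁ (0<s , s<α)) = 0<s , ≤-trans (<⇒≤ s<α) (m≤n⇒m≤1+n (n≤1+n α))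
  G-sum (inj₂ (inj₁ (s≡α , _))) = subst (λ z → 0 < z × z ≤ suc h) (sym s≡α) (z<s , m≤n⇒m≤1+n (n≤1+n α))
  G-sum (inj₂ (inj₂ (inj₁ (s≡h , _)))) = subst (λ z → 0 < z × z ≤ suc h) (sym s≡h) (z<s , n≤1+n h)
  G-sum (inj₂ (inj₂ (inj₂ (s≡1+h , _)))) = subst (λ z → 0 < z × z ≤ suc h) (sym s≡1+h) (z<s , ≤-refl)

  G-free : NegReverseFree G
  G-free a b a′ b′ a<q _ _ _ g g′ e₁ e₂ = go g g′
    where
    s = (a + b) % q
    s′ = (a′ + b′) % q
    s+s′≡q : s + s′ ≡ q
    s+s′≡q = ≈0⇒≡q (m%n<n (a + b) q) (m%n<n (a′ + b′) q) (proj₁ (G-sum g)) (neg-reverse-sums a b a′ b′ e₁ e₂)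
    sums : ∀ {x y} → s ≡ x → s′ ≡ y → x + y ≢ q → ⊥
    sums s≡x s′≡y x+y≢q = x+y≢q (trans (cong₂ _+_ (sym s≡x) (sym s′≡y)) s+s′≡q)
    <q : ∀ {x y} → x < α → y ≤ suc h → x + y ≢ q
    <q {x} {y} x<α y≤1+h = <⇒≢ (subst (x + y <_) α+[1+h]≡q (+-mono-<-≤ x<α y≤1+h))
    ≤q : ∀ {x y} → x ≤ α → y ≤ h → x + y ≢ q
    ≤q {x} {y} x≤α y≤h = <⇒≢ (subst (x + y <_) α+[1+h]≡q (+-mono-≤-< x≤α (s≤s y≤h)))
    >q : ∀ {x y} → h ≤ x → h < y → x + y ≢ q
    >q {x} {y} h≤x h<y x+y≡q = <⇒≢ (subst (_< x + y) (sym q≡h+h) (+-mono-≤-< h≤x h<y)) (sym x+y≡q)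
    go : G a b → G a′ b′ → ⊥
    go (inj₁ (_ , s<α)) g′ = <q s<α (proj₂ (G-sum g′)) s+s′≡q
    go g (inj₁ (_ , s′<α)) = <q s′<α (proj₂ (G-sum g)) (trans (+-comm s′ s) s+s′≡q)
    go (inj₂ (inj₁ (s≡α , _))) (inj₂ (inj₁ (s′≡α , _))) = sums s≡α s′≡α (≤q ≤-refl (n≤1+n α))
    go (inj₂ (inj₁ (s≡α , _))) (inj₂ (inj₂ (inj₁ (s′≡h , _)))) = sums s≡α s′≡h (≤q ≤-refl ≤-refl)
    go (inj₂ (inj₁ (s≡α , a≤α))) (inj₂ (inj₂ (inj₂ (_ , 0<a′ , a′≤h)))) =
      <⇒≱ (subst (α <_) (neg-reverse-shift a<q e₂ s≡α a′+α<q) (m<n+m α 0<a′)) a≤α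
      where
      a′+α<q : a′ + α < q
      a′+α<q = ≤-<-trans (+-monoˡ-≤ α a′≤h) (subst (h + α <_) (trans (+-comm (suc h) α) α+[1+h]≡q) (n<1+n (h + α)))
    go (inj₂ (inj₂ (inj₁ (s≡h , _)))) (inj₂ (inj₁ (s′≡α , _))) =
      sums s≡h s′≡α (λ e → ≤q ≤-refl ≤-refl (trans (+-comm α h) e))
    go (inj₂ (inj₂ (inj₁ (s≡h , _ , a<h)))) (inj₂ (inj₂ (inj₁ (_ , _ , a′<h)))) =
      <⇒≱ a<h (subst (h ≤_) (neg-reverse-shift a<q e₂ s≡h (subst (a′ + h <_) (sym q≡h+h) (+-monoˡ-< h a′<h))) (m≤n+m h a′))
    go (inj₂ (inj₂ (inj₁ (s≡h , _)))) (inj₂ (inj₂ (inj₂ (s′≡1+h , _)))) = sums s≡h s′≡1+h (>q ≤-refl (n<1+n h))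
    go (inj₂ (inj₂ (inj₂ (s≡1+h , 0<a , a≤h)))) (inj₂ (inj₁ (_ , a′≤α))) =
      <⇒≱ (s≤s a≤h) (neg-reverse-≥ a<q 0<a e₂ s≡1+h (subst (a′ + suc h ≤_) α+[1+h]≡q (+-monoˡ-≤ (suc h) a′≤α)))
    go (inj₂ (inj₂ (inj₂ (s≡1+h , _)))) (inj₂ (inj₂ (inj₁ (s′≡h , _)))) =
      sums s≡1+h s′≡h (λ e → >q ≤-refl (n<1+n h) (trans (+-comm h (suc h)) e))
    go (inj₂ (inj₂ (inj₂ (s≡1+h , _)))) (inj₂ (inj₂ (inj₂ (s′≡1+h , _)))) = sums s≡1+h s′≡1+h (>q (n≤1+n h) (n<1+n h))

  module Z = Zigzag q α

  zig∈G : ∀ j → j ≤ α → G j (α ∸ j)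
  zig∈G j j≤α = inj₂ (inj₁ (trans (cong (_% q) (m+[n∸m]≡n j≤α)) (m<n⇒m%n≡m (<-trans (n<1+n α) h<q)) , j≤α))

  zag∈G : ∀ j → j < α → G (α ∸ j) (suc j)
  zag∈G j j<α = inj₂ (inj₂ (inj₁ (trans (cong (_% q) (trans (+-suc (α ∸ j) j) (cong suc (m∸n+n≡m (<⇒≤ j<α))))) (m<n⇒m%n≡m h<q)
                                 , m<n⇒0<n∸m j<α , s≤s (m∸n≤m α j))))

  zigzag : ClosedWalk G
  zigzag = Z.zigzag h<q zig∈G zag∈G

  N : ℕ
  N = suc g′

  module B = Blocks q 1 (suc h) g N

  N*2<α : N * 2 < α
  N*2<α = ≤-refl

  N*2<q : N * 2 < q
  N*2<q = <-trans N*2<α (<-trans (n<1+n α) h<q)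

  g<q : g < q
  g<q = <-trans (s≤s (s≤s (s≤s (m≤m*n g′ 2)))) (<-trans (n<1+n α) h<q)

  1+g≤h : suc g ≤ h
  1+g≤h = s≤s (s≤s (m≤m*n (suc g′) 2))

  1+h≢block-sum : ∀ s → 0 < s → s ≤ N * 2 → s ≢ suc h % q
  1+h≢block-sum s _ s≤2N s≡1+h =
    <⇒≢ (≤-<-trans s≤2N (<-trans N*2<α (<-trans (n<1+n α) (n<1+n h)))) (trans s≡1+h (m<n⇒m%n≡m 1+h<q))

  out∈G : ∀ j → j < g → G ((1 + j) % q) ((suc h ⊖ (1 + j)) % q)
  out∈G j j<g = inj₂ (inj₂ (inj₂ (trans (⊖-sumˡ (1 + j) (suc h)) (m<n⇒m%n≡m 1+h<q)
                                  , subst (λ z → 0 < z × z ≤ h) (sym (m<n⇒m%n≡m (<-trans 1+j<h h<q))) (z<s , <⇒≤ 1+j<h))))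
    where
    1+j<h : 1 + j < h
    1+j<h = <-≤-trans (s≤s j<g) 1+g≤h

  back∈G : ∀ j → j < g → G ((suc h ⊖ (1 + j)) % q) ((1 + j) % q)
  back∈G j j<g = inj₂ (inj₂ (inj₂ (trans (⊖-sumʳ (1 + j) (suc h)) (m<n⇒m%n≡m 1+h<q)
    , subst (λ z → 0 < z × z ≤ h) (sym (trans ([m⊖n]%q≡m⊖n (suc h) (1 + j)) ([1+2K]⊖[1+j]≡2K∸j j<g h<q)))
            (m<n⇒0<n∸m (≤-trans j<g (m≤m*n g 2)) , m∸n≤m h j))))

  σ+1≤2N : ∀ i → i < N → suc (B.σ i) ≤ N * 2
  σ+1≤2N i i<N = *-monoˡ-≤ 2 i<N

  odd∈G : ∀ i j → i < N → j < q → G ((1 + j) % q) ((B.σ i ⊖ (1 + j)) % q)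
  odd∈G i j i<N _ = inj₁ (subst (λ s → 0 < s × s < α) (sym (trans (⊖-sumˡ (1 + j) (B.σ i)) (m<n⇒m%n≡m σ<q))) (z<s , σ<α))
    where
    σ<α = <-trans (σ+1≤2N i i<N) N*2<α
    σ<q = <-trans (n<1+n (B.σ i)) (≤-<-trans (σ+1≤2N i i<N) N*2<q)

  even∈G : ∀ i j → i < N → j < q → G ((B.σ i ⊖ (1 + j)) % q) ((1 + suc j) % q)
  even∈G i j i<N _ = inj₁ (subst (λ s → 0 < s × s < α) (sym (trans (⊖-sum-suc (1 + j) (B.σ i)) (m<n⇒m%n≡m σ+1<q))) (z<s , σ+1<α))
    where
    σ+1<α = ≤-<-trans (σ+1≤2N i i<N) N*2<α
    σ+1<q = ≤-<-trans (σ+1≤2N i i<N) N*2<q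

  module BP = B.Properties g<q (inj₁ z<s) N*2<q 1+h≢block-sum (λ j j<g → K≤[1+2K]⊖[1+j]⊖1 j<g h<q) G out∈G back∈G odd∈G even∈G

  in-blocks : ℕ → ℕ → Bool
  in-blocks a b = does ((a + b) % q ≤? N * 2) ∨ does ((a + b) % q ≟ suc h % q)

  2N<1+h : N * 2 < suc h
  2N<1+h = <-trans N*2<α (<-trans (n<1+n α) (n<1+n h))

  in-blocks-true : ∀ {s} → (0 < s × s ≤ N * 2) ⊎ (s ≡ suc h % q) → does (s ≤? N * 2) ∨ does (s ≟ suc h % q) ≡ true
  in-blocks-true {s} (inj₁ (_ , s≤2N)) rewrite dec-true (s ≤? N * 2) s≤2N = refl
  in-blocks-true {s} (inj₂ s≡1+h)
    rewrite dec-false (s ≤? N * 2) (λ s≤2N → <⇒≱ 2N<1+h (subst (_≤ N * 2) (trans s≡1+h (m<n⇒m%n≡m 1+h<q)) s≤2N))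
          | dec-true (s ≟ suc h % q) s≡1+h = refl

  in-blocks-false : ∀ {s} → (s ≡ α) ⊎ (s ≡ suc α) → does (s ≤? N * 2) ∨ does (s ≟ suc h % q) ≡ false
  in-blocks-false {s} (inj₁ s≡α)
    rewrite dec-false (s ≤? N * 2) (λ s≤2N → <⇒≱ N*2<α (subst (_≤ N * 2) s≡α s≤2N))
          | dec-false (s ≟ suc h % q)
              (λ s≡1+h → <⇒≢ (<-trans (n<1+n α) (n<1+n h)) (trans (sym s≡α) (trans s≡1+h (m<n⇒m%n≡m 1+h<q)))) = refl
  in-blocks-false {s} (inj₂ s≡h)
    rewrite dec-false (s ≤? N * 2) (λ s≤2N → <⇒≱ (<-trans N*2<α (n<1+n α)) (subst (_≤ N * 2) s≡h s≤2N))
          | dec-false (s ≟ suc h % q) (λ s≡1+h → <⇒≢ (n<1+n h) (trans (sym s≡h) (trans s≡1+h (m<n⇒m%n≡m 1+h<q)))) = refl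

  module S = Splice zigzag BP.blocks 2 in-blocks (s≤s (s≤s z≤n)) (cong (_% q) BP.f-0)
    (λ p p<L → in-blocks-true (BP.arc-sum p p<L)) (λ p p<L → in-blocks-false (Z.arc-sum h<q p p<L))

  -- In the last block, the arc leaving vertex (g′, j₀, 1) is a loop at 5 + 3 g′.
  j₀ : ℕ
  j₀ = 3 + g′ * 3

  c : ℕ
  c = 1 + suc j₀

  j₀<q : j₀ < q
  j₀<q = ≤-trans (s≤s (m≤m+n j₀ (g′ + 4))) (≤-reflexive (lemma g′))
    where
    lemma : ∀ g′ → suc (3 + g′ * 3 + (g′ + 4)) ≡ suc (suc g′) * 2 * 2
    lemma = solve-∀

  c<q : c < q
  c<q = ≤-trans (s≤s (s≤s (s≤s (m≤m+n j₀ (g′ + 2))))) (≤-reflexive (lemma g′))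
    where
    lemma : ∀ g′ → suc (suc (suc (3 + g′ * 3 + (g′ + 2)))) ≡ suc (suc g′) * 2 * 2
    lemma = solve-∀

  no-detour : B.NoDetour g′ j₀
  no-detour = inj₂ (≤-trans (s≤s (s≤s (m≤m*n g′ 3))) (s≤s (s≤s (n≤1+n _))))

  bp : ℕ
  bp = B.block-pos g′ j₀ 1

  bp<L : bp < B.L
  bp<L = +-monoʳ-< (g * 2)
    (+-monoˡ-≤ (g′ * (q * 2)) (<-≤-trans (+-monoˡ-< (j₀ * 2) {1} {2} (s≤s (s≤s z≤n))) (*-monoˡ-≤ 2 j₀<q)))

  B-f-bp : B.f bp ≈ c
  B-f-bp = cong (_% q) (trans (BP.f-block g′ j₀ 1 (s<s z<s) j₀<q no-detour)
    (⊖-unique {B.σ g′} {1 + j₀} {c} c<q (trans (sym (m+q≈m (B.σ g′))) (cong (_% q) (lemma g′)))))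
    where
    lemma : ∀ g′ → 1 + g′ * 2 + suc (suc g′) * 2 * 2 ≡ (1 + (3 + g′ * 3)) + (1 + suc (3 + g′ * 3))
    lemma = solve-∀

  B-f-next : B.f (suc bp) ≈ c
  B-f-next = BP.f-after-block g′ j₀ j₀<q no-detour

  p₀ : ℕ
  p₀ = 2 + bp

  p₀<L′ : p₀ < S.L′
  p₀<L′ = <-≤-trans (+-monoʳ-< 2 bp<L) (+-monoˡ-≤ B.L {2} {Z.L} (s≤s (s≤s z≤n)))

  f′-p₀ : S.f′ p₀ ≈ c
  f′-p₀ = trans (ArcOf.head (S.arc-inside bp bp<L)) B-f-bp

  loop : S.f′ p₀ ≈ S.f′ (suc p₀)
  loop = trans f′-p₀ (sym (trans (ArcOf.tail (S.arc-inside bp bp<L)) B-f-next))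

  module R = RemoveLoop S.spliced p₀ p₀<L′ loop

  w₀ : ℕ
  w₀ = suc (g * g * 2)

  weight≈w₀ : weight R.removed ≈ w₀
  weight≈w₀ = +-cancelʳ-≈ {weight R.removed} {w₀} c (begin
    (weight R.removed + c) % q                  ≡⟨ +-congˡ≈ (weight R.removed) f′-p₀ ⟨
    (weight R.removed + S.f′ p₀) % q              ≡⟨ cong (_% q) R.weight-removed ⟩
    weight S.spliced % q                        ≡⟨ cong (_% q) S.weight-spliced ⟩
    (weight zigzag + weight BP.blocks) % q    ≡⟨ +-cong≈ {weight zigzag} {α * α + α} {weight BP.blocks} {g * suc h}
                                                   (Z.weight-zigzag h<q {G} zig∈G zag∈G) BP.weight-blocks ⟩
    (α * α + α + g * suc h) % q               ≡⟨ cong (_% q) (lemma g′) ⟩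
    (w₀ + c + N * q) % q                      ≡⟨ m+k*q≈m (w₀ + c) N ⟩
    (w₀ + c) % q                              ∎)
    where
    open ≡-Reasoning
    lemma : ∀ g′ → suc (suc (suc (g′ * 2))) * suc (suc (suc (g′ * 2))) + suc (suc (suc (g′ * 2)))
                   + suc (suc g′) * suc (suc (suc g′) * 2)
                 ≡ suc (suc (suc g′) * suc (suc g′) * 2) + (1 + suc (3 + g′ * 3)) + suc g′ * (suc (suc g′) * 2 * 2)
    lemma = solve-∀

  -- w₀ = 1 + 2 g² is its own inverse modulo q = 4 g.
  unit : weight R.removed * w₀ ≈ 1
  unit = trans (*-cong≈ {weight R.removed} {w₀} {w₀} {w₀} weight≈w₀ refl)
               (trans (cong (_% q) (lemma g′)) (m+k*q≈m 1 (g * g * g + g)))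
    where
    lemma : ∀ g′ → suc (suc (suc g′) * suc (suc g′) * 2) * suc (suc (suc g′) * suc (suc g′) * 2)
                 ≡ 1 + (suc (suc g′) * suc (suc g′) * suc (suc g′) + suc (suc g′)) * (suc (suc g′) * 2 * 2)
    lemma = solve-∀

  long : bound q ≤ q * R.L′
  long = ≤-trans (bound-even h) (≤-reflexive (cong (λ x → q * (x ∸ 2)) (lemma g′)))
    where
    lemma : ∀ g′ → suc (suc g′) * 2 * (7 + g′ * 2 * 2)
                 ≡ suc ((1 + suc (suc (suc (g′ * 2))) * 2) + (suc (suc g′) * 2 + suc g′ * (suc (suc g′) * 2 * 2 * 2)))
    lemma = solve-∀

  orientable : OrientableAboveBound q
  orientable = orientable-from-walk R.removed G-free (<-≤-trans z<s R.p₀≤L′) w₀ unit long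

module Four where
  open Walks 4

  f : ℕ → ℕ
  f 1 = 1
  f 2 = 1
  f 3 = 2
  f 4 = 1
  f _ = 0

  data G : ℕ → ℕ → Set where
    g01 : G 0 1
    g11 : G 1 1
    g12 : G 1 2
    g21 : G 2 1
    g10 : G 1 0

  D : ℕ → ℕ → ℕ
  D 1 1 = 1
  D 1 2 = 2
  D 2 1 = 3
  D 1 0 = 4
  D _ _ = 0

  arc∈G : ∀ p → p < 5 → G (f p % 4) (f (suc p) % 4)
  arc∈G 0 _ = g01
  arc∈G 1 _ = g11
  arc∈G 2 _ = g12
  arc∈G 3 _ = g21
  arc∈G 4 _ = g10
  arc∈G (suc (suc (suc (suc (suc _))))) (s≤s (s≤s (s≤s (s≤s (s≤s ())))))

  D-arc : ∀ p → p < 5 → D (f p % 4) (f (suc p) % 4) ≡ p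
  D-arc 0 _ = refl
  D-arc 1 _ = refl
  D-arc 2 _ = refl
  D-arc 3 _ = refl
  D-arc 4 _ = refl
  D-arc (suc (suc (suc (suc (suc _))))) (s≤s (s≤s (s≤s (s≤s (s≤s ())))))

  walk : ClosedWalk G
  walk = record { L = 5 ; f = f ; closes = refl ; arc∈G = arc∈G ; D = D ; D-arc = D-arc }

  G-free : NegReverseFree G
  G-free _ _ _ _ _ _ _ _ g01 g01 () _
  G-free _ _ _ _ _ _ _ _ g01 g11 () _
  G-free _ _ _ _ _ _ _ _ g01 g12 () _
  G-free _ _ _ _ _ _ _ _ g01 g21 () _
  G-free _ _ _ _ _ _ _ _ g01 g10 _ ()
  G-free _ _ _ _ _ _ _ _ g11 g01 () _
  G-free _ _ _ _ _ _ _ _ g11 g11 () _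
  G-free _ _ _ _ _ _ _ _ g11 g12 () _
  G-free _ _ _ _ _ _ _ _ g11 g21 () _
  G-free _ _ _ _ _ _ _ _ g11 g10 () _
  G-free _ _ _ _ _ _ _ _ g12 g01 () _
  G-free _ _ _ _ _ _ _ _ g12 g11 () _
  G-free _ _ _ _ _ _ _ _ g12 g12 () _
  G-free _ _ _ _ _ _ _ _ g12 g21 () _
  G-free _ _ _ _ _ _ _ _ g12 g10 () _
  G-free _ _ _ _ _ _ _ _ g21 g01 () _
  G-free _ _ _ _ _ _ _ _ g21 g11 () _
  G-free _ _ _ _ _ _ _ _ g21 g12 _ ()
  G-free _ _ _ _ _ _ _ _ g21 g21 () _
  G-free _ _ _ _ _ _ _ _ g21 g10 () _
  G-free _ _ _ _ _ _ _ _ g10 g01 () _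
  G-free _ _ _ _ _ _ _ _ g10 g11 () _
  G-free _ _ _ _ _ _ _ _ g10 g12 () _
  G-free _ _ _ _ _ _ _ _ g10 g21 () _
  G-free _ _ _ _ _ _ _ _ g10 g10 () _

  orientable : OrientableAboveBound 4
  orientable = orientable-from-walk walk G-free z<s 1 refl (toWitness {a? = bound 4 ≤? 4 * 5} _)

theorem4 : (q : ℕ) → q > 2 →
    ∃[ m ] Σ (NonZero m) λ nz → ∃[ s ] (IsOrientable {q} s 3 m {{nz}} × m ≥ bound q)
theorem4 q q>2 with even⊎odd q
... | inj₂ (k , q≡2k+1) with even⊎odd k
...   | inj₁ (zero , refl) = ⊥-elim (<⇒≱ q>2 (≤-trans (≤-reflexive q≡2k+1) (s≤s z≤n)))
...   | inj₁ (suc n , refl) = subst OrientableAboveBound (sym q≡2k+1) (OneMod4.orientable (suc n) (s≤s z≤n))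
...   | inj₂ (n , refl) = subst OrientableAboveBound (sym q≡2k+1) (ThreeMod4.orientable n)
theorem4 q q>2 | inj₁ (h , q≡2h) with even⊎odd h
... | inj₁ (zero , refl) = ⊥-elim (<⇒≱ q>2 (≤-trans (≤-reflexive q≡2h) z≤n))
... | inj₁ (1 , refl) = subst OrientableAboveBound (sym q≡2h) Four.orientable
... | inj₁ (suc (suc g′) , refl) = subst OrientableAboveBound (sym q≡2h) (ZeroMod4.orientable g′)
... | inj₂ (zero , refl) = ⊥-elim (<⇒≱ q>2 (≤-reflexive q≡2h))
... | inj₂ (suc K , refl) = subst OrientableAboveBound (sym q≡2h) (TwoMod4.orientable (suc K) (s≤s z≤n))
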